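{- Let $T$ be a finite tree and $r$ any vertex of $T$; let $R$ be $T$ rooted at $r$, and let $S_T=(q-1)a_R+qb_R\in\mathbb Z[q]$ where $(a_R,b_R)$ is defined below. Then for every prime power $q$, the value of $S_T$ at $q$ equals the number of invertible Schr\"odinger operators of $T$ over $\mathbb F_q$.
   Context: For a finite rooted tree $R$ define $(a_R,b_R)\in\mathbb Z[q]^2$ recursively: if $R$ is a single vertex, $(a_R,b_R)=(1,0)$; otherwise let $c_1,\dots,c_k$ be the children of the root and $R_i$ the subtree of descendants of $c_i$ rooted at $c_i$; put $e(a,b)=((q-1)a+qb,\,a)$ and multiply pairs by $(a,b)\cdot(\alpha,\beta)=(a\alpha,\,a\beta+b\alpha)$ (i.e. as $a+bt$ modulo $t^2$); then $(a_R,b_R)=\prod_{i=1}^k e(a_{R_i},b_{R_i})$. A Schr\"odinger operator of a graph $G$ over a field is $A+D$ with $A$ the adjacency matrix of $G$ and $D$ an arbitrary diagonal matrix. -}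

module Defs where

open import Level using (0ℓ)
open import Data.Nat as ℕ using (ℕ; zero; suc)
open import Data.Nat.Properties as ℕP using ()
open import Data.Integer as ℤ using (ℤ; +_; -[1+_])
open import Data.Fin using (Fin; toℕ)
open import Data.Bool using (Bool; true; false; if_then_else_; _∨_)
open import Data.List using (List; []; _∷_; _++_; foldr)
import Data.Product.Properties
import Data.List
import Data.Fin
open import Data.List.Membership.DecPropositional (Data.Product.Properties.≡-dec ℕP._≟_ ℕP._≟_)
  using (_∈?_)
open import Data.Product using (_×_; _,_; Σ; proj₁; proj₂)
open import Data.Vec using (Vec; lookup)

open import Relation.Nullary.Decidable using (⌊_⌋)
open import Relation.Binary.PropositionalEquality using (_≡_; _≢_)
open import Relation.Nullary using (¬_)
open import Function.Bundles using (_↔_)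
open import Algebra.Bundles using (CommutativeRing)

-- Polynomials in ℤ[q]: coefficient lists, lowest degree first.

Poly : Set
Poly = List ℤ

infixl 6 _+ₚ_
infixl 7 _*ₚ_ _·ₚ_

_+ₚ_ : Poly → Poly → Poly
[]       +ₚ g        = g
(x ∷ f)  +ₚ []       = x ∷ f
(x ∷ f)  +ₚ (y ∷ g)  = (x ℤ.+ y) ∷ (f +ₚ g)

_·ₚ_ : ℤ → Poly → Poly
c ·ₚ []      = []
c ·ₚ (x ∷ f) = (c ℤ.* x) ∷ (c ·ₚ f)

_*ₚ_ : Poly → Poly → Poly
[]      *ₚ g = []
(x ∷ f) *ₚ g = (x ·ₚ g) +ₚ (+ 0 ∷ (f *ₚ g))

eval : Poly → ℤ → ℤ
eval []      z = + 0
eval (x ∷ f) z = x ℤ.+ z ℤ.* eval f z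

oneₚ : Poly
oneₚ = + 1 ∷ []

zeroₚ : Poly
zeroₚ = []

qₚ : Poly
qₚ = + 0 ∷ + 1 ∷ []

q-1ₚ : Poly
q-1ₚ = -[1+ 0 ] ∷ + 1 ∷ []

-- Finite rooted trees (children form an ordered list; order is irrelevant)

data RTree : Set where
  node : List RTree → RTree

-- the pairs (a,b) ∈ ℤ[q]², multiplied as a + b t mod t²
_⊗_ : Poly × Poly → Poly × Poly → Poly × Poly
(a , b) ⊗ (α , β) = (a *ₚ α , a *ₚ β +ₚ b *ₚ α)

e : Poly × Poly → Poly × Poly
e (a , b) = (q-1ₚ *ₚ a +ₚ qₚ *ₚ b , a)

mutual
  ab : RTree → Poly × Poly
  ab (node cs) = abProd cs

  abProd : List RTree → Poly × Poly
  abProd []       = (oneₚ , zeroₚ)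
  abProd (c ∷ cs) = e (ab c) ⊗ abProd cs

S : RTree → Poly
S R = q-1ₚ *ₚ proj₁ (ab R) +ₚ qₚ *ₚ proj₂ (ab R)

-- The underlying tree graph: vertices numbered 0 … size-1 in preorder
-- (root = 0); edges parent–child.

mutual
  size : RTree → ℕ
  size (node cs) = suc (sizes cs)

  sizes : List RTree → ℕ
  sizes []       = 0
  sizes (c ∷ cs) = size c ℕ.+ sizes cs

mutual
  -- edges of the tree whose root has number k
  edges : ℕ → RTree → List (ℕ × ℕ)
  edges k (node cs) = edgesCh k (suc k) cs

  -- children list of parent p, the first child having number o
  edgesCh : ℕ → ℕ → List RTree → List (ℕ × ℕ)
  edgesCh p o []       = []
  edgesCh p o (c ∷ cs) = (p , o) ∷ (edges o c ++ edgesCh p (o ℕ.+ size c) cs)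

adjacent : (R : RTree) → Fin (size R) → Fin (size R) → Bool
adjacent R i j = ⌊ (toℕ i , toℕ j) ∈? edges 0 R ⌋ ∨ ⌊ (toℕ j , toℕ i) ∈? edges 0 R ⌋

-- Finite fields with q elements.  Field equality is required to be
-- propositional equality.

record FiniteField (q : ℕ) : Set₁ where
  field
    commRing : CommutativeRing 0ℓ 0ℓ
  open CommutativeRing commRing public hiding (ring)
  field
    ≈⇒≡     : ∀ {x y} → x ≈ y → x ≡ y
    0≢1     : ¬ (0# ≈ 1#)
    inverse : ∀ x → ¬ (x ≈ 0#) → Σ Carrier (λ y → x * y ≈ 1#)
    card    : Fin q ↔ Carrier

module Matrices {q : ℕ} (F : FiniteField q) where
  open FiniteField F

  Matrix : ℕ → Set
  Matrix n = Fin n → Fin n → Carrier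

  Σ[_] : ∀ {n} → (Fin n → Carrier) → Carrier
  Σ[_] {n} f = foldr _+_ 0# (Data.List.map f (Data.List.allFin n))

  _⊠_ : ∀ {n} → Matrix n → Matrix n → Matrix n
  (M ⊠ N) i j = Σ[ (λ k → M i k * N k j) ]

  I : ∀ {n} → Matrix n
  I i j = if ⌊ i Data.Fin.≟ j ⌋ then 1# else 0#

  _⊞_ : ∀ {n} → Matrix n → Matrix n → Matrix n
  (M ⊞ N) i j = M i j + N i j

  diag : ∀ {n} → Vec Carrier n → Matrix n
  diag D i j = if ⌊ i Data.Fin.≟ j ⌋ then lookup D i else 0#

  Invertible : ∀ {n} → Matrix n → Set
  Invertible M = Σ (Matrix _) λ B →
    (∀ i j → (M ⊠ B) i j ≈ I i j) × (∀ i j → (B ⊠ M) i j ≈ I i j)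

  adjMatrix : (R : RTree) → Matrix (size R)
  adjMatrix R i j = if adjacent R i j then 1# else 0#

  schrodinger : (R : RTree) → Vec Carrier (size R) → Matrix (size R)
  schrodinger R d = adjMatrix R ⊞ diag d

-- Proof by leaf-to-root elimination.  A subtree hanging below a parent of
-- value p (which enters its root equation) is, for a given diagonal,
-- `regular` with gain g (unique solutions, root value affine in p with
-- slope -g), `critical` (the right-hand side forces p; the root value is
-- free) or `degenerate` (a kernel vector vanishing at the root).  The
-- children of a vertex are `allRegular` with total gain σ, `oneCritical`
-- or `bad`; the vertex is then regular iff d ≠ σ, critical iff d = σ,
-- regular, resp. degenerate (`Elimination`).  The Schrödinger matrix is
-- invertible iff the whole tree is regular (`Invertibility`, after
-- identifying tree-shaped vectors with preorder-indexed vectors).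
-- Counting diagonals by class (`Counting`) yields #critical = #allRegular,
--   #allRegular(c ∷ cs) = #regular(c) #allRegular(cs),
--   #oneCritical(c ∷ cs) = #regular(c) #oneCritical(cs) + #critical(c) #allRegular(cs),
--   #regular = (q - 1) #allRegular(children) + q #oneCritical(children),
-- the recursion of (a_R , b_R) = (#allRegular , #oneCritical) and S_R.
module Submission where

open import Level using (0ℓ)
open import Data.Nat as ℕ using (ℕ; zero; suc; _<_; _≤_; _∸_; _<?_; z≤n; s≤s; _≡ᵇ_)
import Data.Nat.Properties as ℕP
open import Data.Integer as ℤ using (ℤ)
import Data.Integer.Properties as ℤP
open import Data.Integer.Tactic.RingSolver using (solve-∀)
open import Data.Bool using (Bool; true; false; if_then_else_; _∨_; _∧_; T)
open import Data.Unit using (⊤; tt)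
open import Data.Empty using (⊥-elim)
open import Data.Product using (Σ; _×_; _,_; proj₁; proj₂)
import Data.Product.Properties as ProdP
open import Data.Product.Properties using (,-injectiveˡ; ,-injectiveʳ)
open import Data.Fin using (Fin; zero; suc; toℕ)
import Data.Fin as Fin
import Data.Fin.Properties as FinP
open import Data.List as List using (List; []; _∷_; _++_; foldr; length; cartesianProduct)
import Data.List.Properties as ListP
open import Data.List.Relation.Unary.Any using (here; there)
open import Data.List.Relation.Unary.All as All using (All; []; _∷_)
import Data.List.Relation.Unary.All.Properties as AllP
open import Data.List.Relation.Unary.AllPairs using (AllPairs; []; _∷_)
import Data.List.Relation.Unary.AllPairs.Properties as AllPairsP
open import Data.List.Membership.Propositional using (_∈_)
import Data.List.Membership.Propositional.Properties as ∈P
open import Data.List.Membership.DecPropositional (ProdP.≡-dec ℕP._≟_ ℕP._≟_) using (_∈?_)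
open import Data.List.Relation.Unary.Unique.Propositional using (Unique)
import Data.List.Relation.Unary.Unique.Propositional.Properties as UniqueP
open import Data.Vec as Vec using (Vec; []; _∷_; lookup; tabulate; take; drop)
import Data.Vec.Properties as VecP
open import Function using (_∘_; id)
open import Function.Bundles using (Inverse; Equivalence; _⇔_; mk⇔)
open import Relation.Binary.PropositionalEquality using (_≡_; _≢_; refl; sym; trans; cong; cong₂; subst; module ≡-Reasoning)
open import Relation.Nullary using (¬_; Dec; yes; no)
open import Relation.Nullary.Decidable using (⌊_⌋; T?)
open import Algebra.Bundles using (CommutativeRing)

open import Defs

-- Every commutative ring R receives the canonical ring map ℤ → R.  It is
-- needed to run the ring solver with integer coefficients, whose zero test
-- is computable (a field given abstractly has no computable zero test).
module IntegerCoefficients (R : CommutativeRing 0ℓ 0ℓ) where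
  open import Data.Integer using (+_; -[1+_])
  open CommutativeRing R renaming (refl to ≈-refl; sym to ≈-sym; trans to ≈-trans)
  open import Algebra.Properties.Ring ring using (-0#≈0#; -‿involutive; -1*x≈-x; -‿+-comm)
  open import Algebra.Properties.Semiring.Mult semiring using (×-homo-+; ×1-homo-*) renaming (_×_ to _times_)
  open import Data.Sign as Sign using (Sign)
  open import Data.Sum using (inj₁; inj₂)
  open import Data.Maybe using (Maybe; just; nothing)
  open import Algebra.Solver.Ring.AlmostCommutativeRing using (fromCommutativeRing; _-Raw-AlmostCommutative⟶_)
  open import Relation.Binary.Reasoning.Setoid setoid
  import Relation.Binary.PropositionalEquality as ≡

  ⟦_⟧ℕ : ℕ → Carrier
  ⟦ n ⟧ℕ = n times 1#

  ⟦_⟧ : ℤ → Carrier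
  ⟦ + n ⟧     = ⟦ n ⟧ℕ
  ⟦ -[1+ n ] ⟧ = - ⟦ suc n ⟧ℕ

  ⟦_⟧ₛ : Sign → Carrier
  ⟦ Sign.+ ⟧ₛ = 1#
  ⟦ Sign.- ⟧ₛ = - 1#

  private
    a≈[a+b]-b : ∀ a b → a ≈ (a + b) - b
    a≈[a+b]-b a b = begin
      a             ≈⟨ ≈-sym (+-identityʳ a) ⟩
      a + 0#        ≈⟨ +-congˡ (≈-sym (-‿inverseʳ b)) ⟩
      a + (b - b)   ≈⟨ ≈-sym (+-assoc a b (- b)) ⟩
      (a + b) - b   ∎

  ⊖-homo : ∀ m n → ⟦ m ℤ.⊖ n ⟧ ≈ ⟦ m ⟧ℕ - ⟦ n ⟧ℕ
  ⊖-homo m n with ℕP.≤-<-connex n m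
  ... | inj₁ n≤m = begin
    ⟦ m ℤ.⊖ n ⟧                        ≡⟨ cong ⟦_⟧ (ℤP.⊖-≥ n≤m) ⟩
    ⟦ m ∸ n ⟧ℕ                          ≈⟨ a≈[a+b]-b _ _ ⟩
    (⟦ m ∸ n ⟧ℕ + ⟦ n ⟧ℕ) - ⟦ n ⟧ℕ      ≈⟨ +-congʳ (≈-sym (×-homo-+ 1# (m ∸ n) n)) ⟩
    ⟦ m ∸ n ℕ.+ n ⟧ℕ - ⟦ n ⟧ℕ           ≡⟨ cong (λ k → ⟦ k ⟧ℕ - ⟦ n ⟧ℕ) (ℕP.m∸n+n≡m n≤m) ⟩
    ⟦ m ⟧ℕ - ⟦ n ⟧ℕ                     ∎
  ... | inj₂ m<n = begin
    ⟦ m ℤ.⊖ n ⟧                        ≡⟨ cong ⟦_⟧ (ℤP.⊖-< m<n) ⟩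
    ⟦ ℤ.- (+ k) ⟧                       ≈⟨ neg k ⟩
    - ⟦ k ⟧ℕ                            ≈⟨ a≈[a+b]-b _ _ ⟩
    (- ⟦ k ⟧ℕ + ⟦ m ⟧ℕ) - ⟦ m ⟧ℕ        ≈⟨ +-congʳ (+-comm _ _) ⟩
    (⟦ m ⟧ℕ - ⟦ k ⟧ℕ) - ⟦ m ⟧ℕ          ≈⟨ +-assoc _ _ _ ⟩
    ⟦ m ⟧ℕ + (- ⟦ k ⟧ℕ - ⟦ m ⟧ℕ)        ≈⟨ +-congˡ (-‿+-comm _ _) ⟩
    ⟦ m ⟧ℕ - (⟦ k ⟧ℕ + ⟦ m ⟧ℕ)          ≈⟨ +-congˡ (-‿cong (≈-sym (×-homo-+ 1# k m))) ⟩
    ⟦ m ⟧ℕ - ⟦ k ℕ.+ m ⟧ℕ               ≡⟨ cong (λ j → ⟦ m ⟧ℕ - ⟦ j ⟧ℕ) (ℕP.m∸n+n≡m (ℕP.<⇒≤ m<n)) ⟩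
    ⟦ m ⟧ℕ - ⟦ n ⟧ℕ                     ∎
    where
    k = n ∸ m
    neg : ∀ k → ⟦ ℤ.- (+ k) ⟧ ≈ - ⟦ k ⟧ℕ
    neg zero    = ≈-sym -0#≈0#
    neg (suc k) = ≈-refl

  +-homo : ∀ i j → ⟦ i ℤ.+ j ⟧ ≈ ⟦ i ⟧ + ⟦ j ⟧
  +-homo -[1+ m ] -[1+ n ] = begin
    - ⟦ suc (suc (m ℕ.+ n)) ⟧ℕ           ≡⟨ cong (λ k → - ⟦ k ⟧ℕ) (≡.sym (ℕP.+-suc (suc m) n)) ⟩
    - ⟦ suc m ℕ.+ suc n ⟧ℕ                ≈⟨ -‿cong (×-homo-+ 1# (suc m) (suc n)) ⟩
    - (⟦ suc m ⟧ℕ + ⟦ suc n ⟧ℕ)           ≈⟨ ≈-sym (-‿+-comm _ _) ⟩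
    - ⟦ suc m ⟧ℕ - ⟦ suc n ⟧ℕ             ∎
  +-homo -[1+ m ] (+ n)    = ≈-trans (⊖-homo n (suc m)) (+-comm _ _)
  +-homo (+ m)    -[1+ n ] = ⊖-homo m (suc n)
  +-homo (+ m)    (+ n)    = ×-homo-+ 1# m n

  *-homo : ∀ i j → ⟦ i ℤ.* j ⟧ ≈ ⟦ i ⟧ * ⟦ j ⟧
  *-homo i j = begin
    ⟦ i ℤ.* j ⟧                                   ≈⟨ ◃-homo (ℤ.sign i Sign.* ℤ.sign j) (∣i∣ ℕ.* ∣j∣) ⟩
    ⟦ ℤ.sign i Sign.* ℤ.sign j ⟧ₛ * ⟦ ∣i∣ ℕ.* ∣j∣ ⟧ℕ  ≈⟨ *-cong (sign-homo (ℤ.sign i) (ℤ.sign j)) (×1-homo-* ∣i∣ ∣j∣) ⟩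
    (⟦ ℤ.sign i ⟧ₛ * ⟦ ℤ.sign j ⟧ₛ) * (⟦ ∣i∣ ⟧ℕ * ⟦ ∣j∣ ⟧ℕ) ≈⟨ interchange _ _ _ _ ⟩
    (⟦ ℤ.sign i ⟧ₛ * ⟦ ∣i∣ ⟧ℕ) * (⟦ ℤ.sign j ⟧ₛ * ⟦ ∣j∣ ⟧ℕ) ≈⟨ ≈-sym (*-cong (sign-abs i) (sign-abs j)) ⟩
    ⟦ i ⟧ * ⟦ j ⟧                                 ∎
    where
    ∣i∣ = ℤ.∣ i ∣
    ∣j∣ = ℤ.∣ j ∣
    ◃-homo : ∀ s n → ⟦ s ℤ.◃ n ⟧ ≈ ⟦ s ⟧ₛ * ⟦ n ⟧ℕ
    ◃-homo s        zero    = ≈-sym (zeroʳ _)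
    ◃-homo Sign.+ (suc n) = ≈-sym (*-identityˡ _)
    ◃-homo Sign.- (suc n) = ≈-sym (-1*x≈-x _)
    sign-abs : ∀ i → ⟦ i ⟧ ≈ ⟦ ℤ.sign i ⟧ₛ * ⟦ ℤ.∣ i ∣ ⟧ℕ
    sign-abs (+ n)    = ≈-sym (*-identityˡ _)
    sign-abs -[1+ n ] = ≈-sym (-1*x≈-x _)
    sign-homo : ∀ s t → ⟦ s Sign.* t ⟧ₛ ≈ ⟦ s ⟧ₛ * ⟦ t ⟧ₛ
    sign-homo Sign.+ t      = ≈-sym (*-identityˡ _)
    sign-homo Sign.- Sign.+ = ≈-sym (*-identityʳ _)
    sign-homo Sign.- Sign.- = ≈-sym (≈-trans (-1*x≈-x (- 1#)) (-‿involutive 1#))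
    interchange : ∀ a b c d → (a * b) * (c * d) ≈ (a * c) * (b * d)
    interchange a b c d = begin
      (a * b) * (c * d) ≈⟨ *-assoc a b (c * d) ⟩
      a * (b * (c * d)) ≈⟨ *-congˡ (≈-sym (*-assoc b c d)) ⟩
      a * ((b * c) * d) ≈⟨ *-congˡ (*-congʳ (*-comm b c)) ⟩
      a * ((c * b) * d) ≈⟨ *-congˡ (*-assoc c b d) ⟩
      a * (c * (b * d)) ≈⟨ ≈-sym (*-assoc a c (b * d)) ⟩
      (a * c) * (b * d) ∎

  -‿homo : ∀ i → ⟦ ℤ.- i ⟧ ≈ - ⟦ i ⟧
  -‿homo (+ zero)  = ≈-sym -0#≈0#
  -‿homo (+ suc n) = ≈-refl
  -‿homo -[1+ n ]  = ≈-sym (-‿involutive _)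

  homomorphism : ℤ.+-*-rawRing -Raw-AlmostCommutative⟶ fromCommutativeRing R
  homomorphism = record
    { ⟦_⟧ = ⟦_⟧ ; +-homo = +-homo ; *-homo = *-homo ; -‿homo = -‿homo
    ; 0-homo = ≈-refl ; 1-homo = +-identityʳ 1# }

  coefficient-test : ∀ a b → Maybe (⟦ a ⟧ ≈ ⟦ b ⟧)
  coefficient-test a b with a ℤ.≟ b
  ... | yes ≡.refl = just ≈-refl
  ... | no _     = nothing

  open import Algebra.Solver.Ring ℤ.+-*-rawRing (fromCommutativeRing R) homomorphism coefficient-test public
    using (solve; _:=_; _:+_; _:*_; _:-_; con)

module Arithmetic {q : ℕ} (F : FiniteField q) where
  open FiniteField F public using (Carrier; 0#; 1#; _+_; _*_; -_; _-_; ≈⇒≡)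
  open FiniteField F using (_≈_; commRing; card; inverse)
  module CR = FiniteField F
  open ≡-Reasoning

  ≡⇒≈ : ∀ {x y} → x ≡ y → x ≈ y
  ≡⇒≈ refl = CR.refl

  -- Equality of field elements is decidable, as they are listed by Fin q.
  _≟_ : (x y : Carrier) → Dec (x ≡ y)
  x ≟ y with Inverse.from card x FinP.≟ Inverse.from card y
  ... | yes e = yes (trans (sym (Inverse.strictlyInverseˡ card x))
                     (trans (cong (Inverse.to card) e) (Inverse.strictlyInverseˡ card y)))
  ... | no ne = no (λ e → ne (cong (Inverse.from card) e))

  open IntegerCoefficients commRing public using (solve; _:=_; _:+_; _:*_; _:-_; con)

  0#≢1# : ¬ (0# ≡ 1#)
  0#≢1# e = FiniteField.0≢1 F (≡⇒≈ e)

  +-identityˡ : ∀ x → 0# + x ≡ x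
  +-identityˡ x = ≈⇒≡ (CR.+-identityˡ x)

  +-identityʳ : ∀ x → x + 0# ≡ x
  +-identityʳ x = ≈⇒≡ (CR.+-identityʳ x)

  x-x≡0 : ∀ x → x - x ≡ 0#
  x-x≡0 x = ≈⇒≡ (CR.-‿inverseʳ x)

  inv : (x : Carrier) → ¬ x ≡ 0# → Carrier
  inv x x≢0 = proj₁ (inverse x (λ e → x≢0 (≈⇒≡ e)))

  inv-r : (x : Carrier) (x≢0 : ¬ x ≡ 0#) → x * inv x x≢0 ≡ 1#
  inv-r x x≢0 = ≈⇒≡ (proj₂ (inverse x (λ e → x≢0 (≈⇒≡ e))))

  +-cancelʳ : ∀ a b c → a + c ≡ b + c → a ≡ b
  +-cancelʳ a b c e = begin
    a           ≡⟨ ≈⇒≡ (solve 2 (λ a c → a := (a :+ c) :- c) CR.refl a c) ⟩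
    (a + c) - c ≡⟨ cong (_- c) e ⟩
    (b + c) - c ≡⟨ ≈⇒≡ (solve 2 (λ b c → (b :+ c) :- c := b) CR.refl b c) ⟩
    b           ∎

  +-cancelˡ : ∀ a b c → c + a ≡ c + b → a ≡ b
  +-cancelˡ a b c e = +-cancelʳ a b c (trans (≈⇒≡ (CR.+-comm a c)) (trans e (≈⇒≡ (CR.+-comm c b))))

  a+b≡c⇒a≡c-b : ∀ a b c → a + b ≡ c → a ≡ c - b
  a+b≡c⇒a≡c-b a b c e = +-cancelʳ a (c - b) b
    (trans e (≈⇒≡ (solve 2 (λ b c → c := (c :- b) :+ b) CR.refl b c)))

  a-b≡0⇒a≡b : ∀ a b → a - b ≡ 0# → a ≡ b
  a-b≡0⇒a≡b a b e = +-cancelʳ a b (- b) (trans e (sym (x-x≡0 b)))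

  a≢b⇒a-b≢0 : ∀ {a b} → ¬ a ≡ b → ¬ a - b ≡ 0#
  a≢b⇒a-b≢0 {a} {b} a≢b e = a≢b (a-b≡0⇒a≡b a b e)

  solve-linear : ∀ u g x w → u * g ≡ 1# → u * x ≡ w → x ≡ g * w
  solve-linear u g x w ug≡1 ux≡w = begin
    x           ≡⟨ sym (≈⇒≡ (CR.*-identityˡ x)) ⟩
    1# * x      ≡⟨ cong (_* x) (sym ug≡1) ⟩
    (u * g) * x ≡⟨ ≈⇒≡ (solve 3 (λ u g x → (u :* g) :* x := g :* (u :* x)) CR.refl u g x) ⟩
    g * (u * x) ≡⟨ cong (g *_) ux≡w ⟩
    g * w       ∎

module MatrixFacts {q : ℕ} (F : FiniteField q) where
  open Arithmetic F
  open Matrices F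
  open ≡-Reasoning

  sum : ∀ n → (Fin n → Carrier) → Carrier
  sum zero    f = 0#
  sum (suc n) f = f zero + sum n (f ∘ suc)

  Σ≡sum : ∀ {n} (f : Fin n → Carrier) → Σ[ f ] ≡ sum n f
  Σ≡sum {n} f = trans (cong (foldr _+_ 0#) (ListP.map-tabulate id f)) (foldr-tabulate n f)
    where
    foldr-tabulate : ∀ n (f : Fin n → Carrier) → foldr _+_ 0# (List.tabulate f) ≡ sum n f
    foldr-tabulate zero    f = refl
    foldr-tabulate (suc n) f = cong (f zero +_) (foldr-tabulate n (f ∘ suc))

  sum-cong : ∀ n {f g : Fin n → Carrier} → (∀ i → f i ≡ g i) → sum n f ≡ sum n g
  sum-cong zero    e = refl
  sum-cong (suc n) e = cong₂ _+_ (e zero) (sum-cong n (e ∘ suc))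

  sum-+ : ∀ n (f g : Fin n → Carrier) → sum n (λ i → f i + g i) ≡ sum n f + sum n g
  sum-+ zero    f g = sym (+-identityˡ 0#)
  sum-+ (suc n) f g = trans (cong (f zero + g zero +_) (sum-+ n (f ∘ suc) (g ∘ suc)))
    (≈⇒≡ (solve 4 (λ a b c d → a :+ b :+ (c :+ d) := a :+ c :+ (b :+ d)) CR.refl (f zero) (g zero) _ _))

  sum-*ˡ : ∀ n c (f : Fin n → Carrier) → sum n (λ i → c * f i) ≡ c * sum n f
  sum-*ˡ zero    c f = sym (≈⇒≡ (CR.zeroʳ c))
  sum-*ˡ (suc n) c f = trans (cong (c * f zero +_) (sum-*ˡ n c (f ∘ suc)))
    (sym (≈⇒≡ (CR.distribˡ c (f zero) _)))

  sum-*ʳ : ∀ n c (f : Fin n → Carrier) → sum n (λ i → f i * c) ≡ sum n f * c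
  sum-*ʳ n c f = trans (sum-cong n (λ i → ≈⇒≡ (CR.*-comm (f i) c)))
                       (trans (sum-*ˡ n c f) (≈⇒≡ (CR.*-comm c _)))

  sum-0 : ∀ n → sum n (λ _ → 0#) ≡ 0#
  sum-0 zero    = refl
  sum-0 (suc n) = trans (cong (0# +_) (sum-0 n)) (+-identityˡ 0#)

  sum-swap : ∀ n m (f : Fin n → Fin m → Carrier) →
    sum n (λ i → sum m (f i)) ≡ sum m (λ j → sum n (λ i → f i j))
  sum-swap zero    m f = sym (sum-0 m)
  sum-swap (suc n) m f = trans (cong (sum m (f zero) +_) (sum-swap n m (f ∘ suc)))
                               (sym (sum-+ m (f zero) _))

  I-diag : ∀ {n} (i : Fin n) → I i i ≡ 1#
  I-diag i with i Fin.≟ i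
  ... | yes _ = refl
  ... | no i≢i = ⊥-elim (i≢i refl)

  I-off : ∀ {n} (i j : Fin n) → ¬ i ≡ j → I i j ≡ 0#
  I-off i j i≢j with i Fin.≟ j
  ... | yes e = ⊥-elim (i≢j e)
  ... | no _  = refl

  I-suc : ∀ {n} (i j : Fin n) → I (suc i) (suc j) ≡ I i j
  I-suc i j with i Fin.≟ j
  ... | yes _ = refl
  ... | no _  = refl

  I-sym : ∀ {n} (i j : Fin n) → I i j ≡ I j i
  I-sym i j with i Fin.≟ j | j Fin.≟ i
  ... | yes _ | yes _ = refl
  ... | no _  | no _  = refl
  ... | yes e | no ne = ⊥-elim (ne (sym e))
  ... | no ne | yes e = ⊥-elim (ne (sym e))

  sum-I : ∀ n (j : Fin n) (f : Fin n → Carrier) → sum n (λ k → I j k * f k) ≡ f j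
  sum-I (suc n) zero f = begin
    I {suc n} zero zero * f zero + sum n (λ k → I {suc n} zero (suc k) * f (suc k))
      ≡⟨ cong₂ _+_ (cong (_* f zero) (I-diag {suc n} zero))
                   (sum-cong n (λ k → cong (_* f (suc k)) (I-off zero (suc k) (λ ())))) ⟩
    1# * f zero + sum n (λ k → 0# * f (suc k))
      ≡⟨ cong (1# * f zero +_) (trans (sum-*ˡ n 0# (f ∘ suc)) (≈⇒≡ (CR.zeroˡ _))) ⟩
    1# * f zero + 0#  ≡⟨ trans (+-identityʳ _) (≈⇒≡ (CR.*-identityˡ (f zero))) ⟩
    f zero ∎
  sum-I (suc n) (suc j) f = begin
    I (suc j) zero * f zero + sum n (λ k → I (suc j) (suc k) * f (suc k))
      ≡⟨ cong₂ _+_ (cong (_* f zero) (I-off (suc j) zero (λ ())))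
                   (sum-cong n (λ k → cong (_* f (suc k)) (I-suc j k))) ⟩
    0# * f zero + sum n (λ k → I j k * f (suc k))
      ≡⟨ cong₂ _+_ (≈⇒≡ (CR.zeroˡ _)) (sum-I n j (f ∘ suc)) ⟩
    0# + f (suc j) ≡⟨ +-identityˡ _ ⟩
    f (suc j) ∎

  _·_ : ∀ {n} → Matrix n → (Fin n → Carrier) → Fin n → Carrier
  _·_ {n} M v i = sum n (λ k → M i k * v k)

  ⊠≡sum : ∀ {n} (M N : Matrix n) i j → (M ⊠ N) i j ≡ sum n (λ k → M i k * N k j)
  ⊠≡sum M N i j = Σ≡sum (λ k → M i k * N k j)

  ·-congʳ : ∀ {n} (M : Matrix n) {v v' : Fin n → Carrier} → (∀ i → v i ≡ v' i) →
            ∀ i → (M · v) i ≡ (M · v') i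
  ·-congʳ {n} M e i = sum-cong n (λ k → cong (M i k *_) (e k))

  ·-congˡ : ∀ {n} {M M' : Matrix n} (v : Fin n → Carrier) → (∀ i j → M i j ≡ M' i j) →
            ∀ i → (M · v) i ≡ (M' · v) i
  ·-congˡ {n} v e i = sum-cong n (λ k → cong (_* v k) (e i k))

  ·-assoc : ∀ {n} (M N : Matrix n) v i → ((M ⊠ N) · v) i ≡ (M · (N · v)) i
  ·-assoc {n} M N v i = begin
    sum n (λ k → (M ⊠ N) i k * v k)
      ≡⟨ sum-cong n (λ k → trans (cong (_* v k) (⊠≡sum M N i k)) (sym (sum-*ʳ n (v k) _))) ⟩
    sum n (λ k → sum n (λ l → M i l * N l k * v k))
      ≡⟨ sum-swap n n _ ⟩
    sum n (λ l → sum n (λ k → M i l * N l k * v k))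
      ≡⟨ sum-cong n (λ l → trans (sum-cong n (λ k → ≈⇒≡ (CR.*-assoc (M i l) (N l k) (v k))))
                                 (sum-*ˡ n (M i l) _)) ⟩
    sum n (λ l → M i l * sum n (λ k → N l k * v k)) ∎

  I· : ∀ {n} v (i : Fin n) → (I · v) i ≡ v i
  I· {n} v i = sum-I n i v

  ·0 : ∀ {n} (M : Matrix n) i → (M · (λ _ → 0#)) i ≡ 0#
  ·0 {n} M i = trans (sum-cong n (λ k → ≈⇒≡ (CR.zeroʳ (M i k)))) (sum-0 n)

  ·-unit : ∀ {n} (M : Matrix n) i j → (M · (λ k → I k j)) i ≡ M i j
  ·-unit {n} M i j = trans (sum-cong n (λ k → trans (≈⇒≡ (CR.*-comm (M i k) (I k j)))
                                                    (cong (_* M i k) (I-sym k j))))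
                           (sum-I n j (M i))

  -- If every equation M x = y has a solution `solution y`, and M is
  -- injective on vectors, then M has a two-sided inverse (whose columns are
  -- the solutions for the unit vectors).
  invertible-if-bijective : ∀ {n} (M : Matrix n) (solution : (Fin n → Carrier) → Fin n → Carrier) →
    (∀ y i → (M · solution y) i ≡ y i) →
    (∀ v v' → (∀ i → (M · v) i ≡ (M · v') i) → ∀ i → v i ≡ v' i) → Invertible M
  invertible-if-bijective {n} M solution solves injective = B , (λ i j → ≡⇒≈ (M⊠B i j)) , (λ i j → ≡⇒≈ (B⊠M i j))
    where
    B : Matrix n
    B i j = solution (λ k → I k j) i
    M⊠B : ∀ i j → (M ⊠ B) i j ≡ I i j
    M⊠B i j = trans (⊠≡sum M B i j) (solves (λ k → I k j) i)
    -- M (B Mⱼ) = Mⱼ = M eⱼ, so B Mⱼ = eⱼ by injectivity.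
    same-image : ∀ j i → (M · (B · (λ l → M l j))) i ≡ (M · (λ k → I k j)) i
    same-image j i = begin
      (M · (B · (λ l → M l j))) i ≡⟨ sym (·-assoc M B _ i) ⟩
      ((M ⊠ B) · (λ l → M l j)) i ≡⟨ ·-congˡ (λ l → M l j) M⊠B i ⟩
      (I · (λ l → M l j)) i       ≡⟨ I· _ i ⟩
      M i j                       ≡⟨ sym (·-unit M i j) ⟩
      (M · (λ k → I k j)) i       ∎
    B⊠M : ∀ i j → (B ⊠ M) i j ≡ I i j
    B⊠M i j = trans (⊠≡sum B M i j) (injective _ (λ k → I k j) (same-image j) i)

  singular-if-kernel : ∀ {n} (M : Matrix n) (v : Fin n → Carrier) → ¬ (∀ i → v i ≡ 0#) →
    (∀ i → (M · v) i ≡ 0#) → ¬ Invertible M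
  singular-if-kernel {n} M v v≢0 Mv≡0 (B , _ , B⊠M≈I) = v≢0 (λ i → begin
    v i                   ≡⟨ sym (I· v i) ⟩
    (I · v) i             ≡⟨ sym (·-congˡ v (λ i j → ≈⇒≡ (B⊠M≈I i j)) i) ⟩
    ((B ⊠ M) · v) i       ≡⟨ ·-assoc B M v i ⟩
    (B · (M · v)) i       ≡⟨ ·-congʳ B Mv≡0 i ⟩
    (B · (λ _ → 0#)) i    ≡⟨ ·0 B i ⟩
    0#                    ∎)

-- Vectors indexed by the vertices of a rooted tree, stored in the shape of
-- the tree, and the Schrödinger operator acting on them.
module TreeVectors {q : ℕ} (F : FiniteField q) where
  open Arithmetic F

  mutual
    V : RTree → Set
    V (node cs) = Carrier × Vs cs

    Vs : List RTree → Set
    Vs []       = ⊤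
    Vs (c ∷ cs) = V c × Vs cs

  mutual
    0V : ∀ R → V R
    0V (node cs) = 0# , 0Vs cs

    0Vs : ∀ cs → Vs cs
    0Vs []       = tt
    0Vs (c ∷ cs) = 0V c , 0Vs cs

  root : ∀ R → V R → Carrier
  root (node cs) (x , _) = x

  addToRoot : ∀ R → V R → Carrier → V R
  addToRoot (node cs) (x , xs) p = x + p , xs

  roots : ∀ cs → Vs cs → Carrier
  roots []       _        = 0#
  roots (c ∷ cs) (x , xs) = root c x + roots cs xs

  -- op R d x is (A + diag d) x for the tree R.  opP R d p x is the same
  -- operator when R hangs below a parent of value p: the root row gets the
  -- extra term p.  opF is opP for each child of a vertex of value p.
  mutual
    op : ∀ R → V R → V R → V R
    op (node cs) (d , ds) (x , xs) = d * x + roots cs xs , opF cs ds x xs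

    opF : ∀ cs → Vs cs → Carrier → Vs cs → Vs cs
    opF []       _        _ _        = tt
    opF (c ∷ cs) (d , ds) p (x , xs) = opP c d p x , opF cs ds p xs

    opP : ∀ R → V R → Carrier → V R → V R
    opP R d p x = addToRoot R (op R d x) p

  root-0V : ∀ R → root R (0V R) ≡ 0#
  root-0V (node cs) = refl

  roots-0Vs : ∀ cs → roots cs (0Vs cs) ≡ 0#
  roots-0Vs []       = refl
  roots-0Vs (c ∷ cs) = trans (cong₂ _+_ (root-0V c) (roots-0Vs cs)) (+-identityˡ 0#)

  d*0+0+0≡0 : ∀ d → d * 0# + 0# + 0# ≡ 0#
  d*0+0+0≡0 d = ≈⇒≡ (solve 1 (λ d → d :* con (ℤ.+ 0) :+ con (ℤ.+ 0) :+ con (ℤ.+ 0) := con (ℤ.+ 0)) CR.refl d)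

  mutual
    opP-0V : ∀ R d → opP R d 0# (0V R) ≡ 0V R
    opP-0V (node cs) (d , ds) =
      cong₂ _,_ (trans (cong (λ r → d * 0# + r + 0#) (roots-0Vs cs)) (d*0+0+0≡0 d)) (opF-0Vs cs ds)

    opF-0Vs : ∀ cs ds → opF cs ds 0# (0Vs cs) ≡ 0Vs cs
    opF-0Vs []       _        = refl
    opF-0Vs (c ∷ cs) (d , ds) = cong₂ _,_ (opP-0V c d) (opF-0Vs cs ds)

  root≡1⇒≢0V : ∀ R x → root R x ≡ 1# → ¬ x ≡ 0V R
  root≡1⇒≢0V R x r≡1 x≡0 = 0#≢1# (trans (sym (root-0V R)) (trans (cong (root R) (sym x≡0)) r≡1))

module Elimination {q : ℕ} (F : FiniteField q) where
  open Arithmetic F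
  open TreeVectors F
  open ≡-Reasoning

  data Class : Set where
    regular    : Carrier → Class
    critical   : Class
    degenerate : Class

  data ForestClass : Set where
    allRegular  : Carrier → ForestClass
    oneCritical : ForestClass
    bad         : ForestClass

  vertexClassFromGain : (d σ : Carrier) → Dec (d ≡ σ) → Class
  vertexClassFromGain d σ (yes _)   = critical
  vertexClassFromGain d σ (no d≢σ) = regular (inv (d - σ) (a≢b⇒a-b≢0 d≢σ))

  vertexClass : Carrier → ForestClass → Class
  vertexClass d (allRegular σ) = vertexClassFromGain d σ (d ≟ σ)
  vertexClass d oneCritical    = regular 0#
  vertexClass d bad            = degenerate

  addChild : Class → ForestClass → ForestClass
  addChild (regular g) (allRegular σ) = allRegular (g + σ)
  addChild (regular g) oneCritical    = oneCritical
  addChild (regular g) bad            = bad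
  addChild critical    (allRegular σ) = oneCritical
  addChild critical    oneCritical    = bad
  addChild critical    bad            = bad
  addChild degenerate  f              = bad

  mutual
    classify : ∀ R → V R → Class
    classify (node cs) (d , ds) = vertexClass d (classifyF cs ds)

    classifyF : ∀ cs → Vs cs → ForestClass
    classifyF []       _        = allRegular 0#
    classifyF (c ∷ cs) (d , ds) = addChild (classify c d) (classifyF cs ds)

  record Regular (R : RTree) (d : V R) (g : Carrier) : Set where
    field
      offset     : V R → Carrier
      solution   : ∀ y p → Σ (V R) λ x → opP R d p x ≡ y × root R x ≡ offset y - g * p
      root-value : ∀ y p x → opP R d p x ≡ y → root R x ≡ offset y - g * p
      injective  : ∀ p x x' → opP R d p x ≡ opP R d p x' → x ≡ x'

  record Critical (R : RTree) (d : V R) : Set where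
    field
      parentValue : V R → Carrier
      solution    : ∀ y s → Σ (V R) λ x → opP R d (parentValue y) x ≡ y × root R x ≡ s
      forced      : ∀ y p x → opP R d p x ≡ y → p ≡ parentValue y
      injective   : ∀ p x x' → opP R d p x ≡ opP R d p x' → root R x ≡ root R x' → x ≡ x'

  Degenerate : (R : RTree) (d : V R) → Set
  Degenerate R d = Σ (V R) λ x → opP R d 0# x ≡ 0V R × root R x ≡ 0# × ¬ x ≡ 0V R

  record AllRegular (cs : List RTree) (ds : Vs cs) (σ : Carrier) : Set where
    field
      offset      : Vs cs → Carrier
      solution    : ∀ ys p → Σ (Vs cs) λ xs → opF cs ds p xs ≡ ys × roots cs xs ≡ offset ys - σ * p
      roots-value : ∀ ys p xs → opF cs ds p xs ≡ ys → roots cs xs ≡ offset ys - σ * p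
      injective   : ∀ p xs xs' → opF cs ds p xs ≡ opF cs ds p xs' → xs ≡ xs'

  record OneCritical (cs : List RTree) (ds : Vs cs) : Set where
    field
      parentValue : Vs cs → Carrier
      solution    : ∀ ys s → Σ (Vs cs) λ xs → opF cs ds (parentValue ys) xs ≡ ys × roots cs xs ≡ s
      forced      : ∀ ys p xs → opF cs ds p xs ≡ ys → p ≡ parentValue ys
      injective   : ∀ p xs xs' → opF cs ds p xs ≡ opF cs ds p xs' → roots cs xs ≡ roots cs xs' → xs ≡ xs'

  Bad : (cs : List RTree) (ds : Vs cs) → Set
  Bad cs ds = Σ (Vs cs) λ xs → opF cs ds 0# xs ≡ 0Vs cs × roots cs xs ≡ 0# × ¬ xs ≡ 0Vs cs

  Meaning : ∀ R → V R → Class → Set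
  Meaning R d (regular g) = Regular R d g
  Meaning R d critical    = Critical R d
  Meaning R d degenerate  = Degenerate R d

  MeaningF : ∀ cs → Vs cs → ForestClass → Set
  MeaningF cs ds (allRegular σ) = AllRegular cs ds σ
  MeaningF cs ds oneCritical    = OneCritical cs ds
  MeaningF cs ds bad            = Bad cs ds

  critical-kernel : ∀ R d → Critical R d → Σ (V R) λ κ → opP R d 0# κ ≡ 0V R × root R κ ≡ 1#
  critical-kernel R d C with Critical.solution C (0V R) 1#
  ... | κ , e , r = κ , subst (λ p → opP R d p κ ≡ 0V R) p≡0 e , r
    where p≡0 = sym (Critical.forced C (0V R) 0# (0V R) (opP-0V R d))

  oneCritical-kernel : ∀ cs ds → OneCritical cs ds →
    Σ (Vs cs) λ xs → opF cs ds 0# xs ≡ 0Vs cs × roots cs xs ≡ - 1#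
  oneCritical-kernel cs ds O with OneCritical.solution O (0Vs cs) (- 1#)
  ... | xs , e , r = xs , subst (λ p → opF cs ds p xs ≡ 0Vs cs) p≡0 e , r
    where p≡0 = sym (OneCritical.forced O (0Vs cs) 0# (0Vs cs) (opF-0Vs cs ds))

  module _ (c : RTree) (cs : List RTree) (d : V c) (ds : Vs cs) where

    regular∷allRegular : ∀ g σ → Regular c d g → AllRegular cs ds σ → AllRegular (c ∷ cs) (d , ds) (g + σ)
    regular∷allRegular g σ Rc Rcs = record
      { offset = λ { (y , ys) → Rc.offset y + Rcs.offset ys }
      ; solution = λ { (y , ys) p →
          let (x , e₁ , r₁) = Rc.solution y p ; (xs , e₂ , r₂) = Rcs.solution ys p
          in (x , xs) , cong₂ _,_ e₁ e₂ , add-affine p r₁ r₂ }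
      ; roots-value = λ { (y , ys) p (x , xs) e →
          add-affine p (Rc.root-value y p x (,-injectiveˡ e)) (Rcs.roots-value ys p xs (,-injectiveʳ e)) }
      ; injective = λ { p (x , xs) (x' , xs') e →
          cong₂ _,_ (Rc.injective p x x' (,-injectiveˡ e)) (Rcs.injective p xs xs' (,-injectiveʳ e)) }
      }
      where
      module Rc = Regular Rc
      module Rcs = AllRegular Rcs
      add-affine : ∀ {a b r rs} p → r ≡ a - g * p → rs ≡ b - σ * p → r + rs ≡ (a + b) - (g + σ) * p
      add-affine {a} {b} p e₁ e₂ = trans (cong₂ _+_ e₁ e₂)
        (≈⇒≡ (solve 5 (λ a b g σ p → (a :- g :* p) :+ (b :- σ :* p) := (a :+ b) :- (g :+ σ) :* p) CR.refl a b g σ p))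

    regular∷oneCritical : ∀ g → Regular c d g → OneCritical cs ds → OneCritical (c ∷ cs) (d , ds)
    regular∷oneCritical g Rc Ocs = record
      { parentValue = λ { (y , ys) → Ocs.parentValue ys }
      ; solution = λ { (y , ys) s →
          let (x , e₁ , _) = Rc.solution y (Ocs.parentValue ys)
              (xs , e₂ , r₂) = Ocs.solution ys (s - root c x)
          in (x , xs) , cong₂ _,_ e₁ e₂ ,
             trans (cong (root c x +_) r₂) (≈⇒≡ (solve 2 (λ a s → a :+ (s :- a) := s) CR.refl (root c x) s)) }
      ; forced = λ { (y , ys) p (x , xs) e → Ocs.forced ys p xs (,-injectiveʳ e) }
      ; injective = λ { p (x , xs) (x' , xs') e r≡r' →
          let x≡x' = Rc.injective p x x' (,-injectiveˡ e)
          in cong₂ _,_ x≡x' (Ocs.injective p xs xs' (,-injectiveʳ e)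
               (+-cancelˡ _ _ (root c x') (trans (cong (λ z → root c z + roots cs xs) (sym x≡x')) r≡r'))) }
      }
      where
      module Rc = Regular Rc
      module Ocs = OneCritical Ocs

    critical∷allRegular : ∀ σ → Critical c d → AllRegular cs ds σ → OneCritical (c ∷ cs) (d , ds)
    critical∷allRegular σ Cc Rcs = record
      { parentValue = λ { (y , ys) → Cc.parentValue y }
      ; solution = λ { (y , ys) s →
          let (xs , e₂ , _) = Rcs.solution ys (Cc.parentValue y)
              (x , e₁ , r₁) = Cc.solution y (s - roots cs xs)
          in (x , xs) , cong₂ _,_ e₁ e₂ ,
             trans (cong (_+ roots cs xs) r₁) (≈⇒≡ (solve 2 (λ a s → (s :- a) :+ a := s) CR.refl (roots cs xs) s)) }
      ; forced = λ { (y , ys) p (x , xs) e → Cc.forced y p x (,-injectiveˡ e) }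
      ; injective = λ { p (x , xs) (x' , xs') e r≡r' →
          let xs≡xs' = Rcs.injective p xs xs' (,-injectiveʳ e)
          in cong₂ _,_ (Cc.injective p x x' (,-injectiveˡ e)
               (+-cancelʳ _ _ (roots cs xs') (trans (cong (λ z → root c x + roots cs z) (sym xs≡xs')) r≡r'))) xs≡xs' }
      }
      where
      module Cc = Critical Cc
      module Rcs = AllRegular Rcs

    -- two critical children: their kernel vectors (root sums 1 and -1) combine
    critical∷oneCritical : Critical c d → OneCritical cs ds → Bad (c ∷ cs) (d , ds)
    critical∷oneCritical Cc Ocs =
      let (κ , e₁ , r₁) = critical-kernel c d Cc ; (κs , e₂ , r₂) = oneCritical-kernel cs ds Ocs
      in (κ , κs) , cong₂ _,_ e₁ e₂ , trans (cong₂ _+_ r₁ r₂) (x-x≡0 1#) ,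
         λ e → root≡1⇒≢0V c κ r₁ (,-injectiveˡ e)

    any∷bad : Bad cs ds → Bad (c ∷ cs) (d , ds)
    any∷bad (κs , e , r , κs≢0) = (0V c , κs) , cong₂ _,_ (opP-0V c d) e ,
      trans (cong₂ _+_ (root-0V c) r) (+-identityˡ 0#) , λ e' → κs≢0 (,-injectiveʳ e')

    degenerate∷any : Degenerate c d → Bad (c ∷ cs) (d , ds)
    degenerate∷any (κ , e , r , κ≢0) = (κ , 0Vs cs) , cong₂ _,_ e (opF-0Vs cs ds) ,
      trans (cong₂ _+_ r (roots-0Vs cs)) (+-identityˡ 0#) , λ e' → κ≢0 (,-injectiveˡ e')

    addChild-meaning : ∀ k f → Meaning c d k → MeaningF cs ds f → MeaningF (c ∷ cs) (d , ds) (addChild k f)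
    addChild-meaning (regular g) (allRegular σ) m mf = regular∷allRegular g σ m mf
    addChild-meaning (regular g) oneCritical    m mf = regular∷oneCritical g m mf
    addChild-meaning (regular g) bad            m mf = any∷bad mf
    addChild-meaning critical    (allRegular σ) m mf = critical∷allRegular σ m mf
    addChild-meaning critical    oneCritical    m mf = critical∷oneCritical m mf
    addChild-meaning critical    bad            m mf = any∷bad mf
    addChild-meaning degenerate  f              m mf = degenerate∷any m

  module _ (cs : List RTree) (d : Carrier) (ds : Vs cs) where

    root-row : ∀ σ H x rs p → rs ≡ H - σ * x → d * x + rs + p ≡ (d - σ) * x + (H + p)
    root-row σ H x rs p e = trans (cong (λ z → d * x + z + p) e)
      (≈⇒≡ (solve 5 (λ d σ H x p → d :* x :+ (H :- σ :* x) :+ p := (d :- σ) :* x :+ (H :+ p)) CR.refl d σ H x p))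

    allRegular⇒regular : ∀ σ g → AllRegular cs ds σ → (d - σ) * g ≡ 1# → Regular (node cs) (d , ds) g
    allRegular⇒regular σ g Rcs ug≡1 = record
      { offset = λ { (y , ys) → g * (y - Rcs.offset ys) }
      ; solution = λ { (y , ys) p →
          let w = (y - p) - Rcs.offset ys ; (xs , e , r) = Rcs.solution ys (g * w)
          in (g * w , xs) , cong₂ _,_ (solves y ys p xs r) e , distrib-g y p (Rcs.offset ys) }
      ; root-value = λ { (y , ys) p (x , xs) e → root-formula y ys p x xs e }
      ; injective = λ { p (x , xs) (x' , xs') e →
          -- both root values are given by the root formula, so they agree
          let (y , ys) = opP (node cs) (d , ds) p (x , xs)
              x≡x' = trans (root-formula y ys p x xs refl) (sym (root-formula y ys p x' xs' (sym e)))
          in cong₂ _,_ x≡x' (Rcs.injective x xs xs' (trans (,-injectiveʳ e) (cong (λ z → opF cs ds z xs') (sym x≡x')))) }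
      }
      where
      module Rcs = AllRegular Rcs
      u = d - σ
      distrib-g : ∀ y p H → g * ((y - p) - H) ≡ g * (y - H) - g * p
      distrib-g y p H = ≈⇒≡ (solve 4 (λ g y p H → g :* ((y :- p) :- H) := g :* (y :- H) :- g :* p) CR.refl g y p H)
      solves : ∀ y ys p xs → roots cs xs ≡ Rcs.offset ys - σ * (g * ((y - p) - Rcs.offset ys)) →
               d * (g * ((y - p) - Rcs.offset ys)) + roots cs xs + p ≡ y
      solves y ys p xs r = begin
        d * (g * w) + roots cs xs + p  ≡⟨ root-row σ H (g * w) (roots cs xs) p r ⟩
        u * (g * w) + (H + p)          ≡⟨ cong (_+ (H + p)) (≈⇒≡ (CR.sym (CR.*-assoc u g w))) ⟩
        (u * g) * w + (H + p)          ≡⟨ cong (λ z → z * w + (H + p)) ug≡1 ⟩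
        1# * w + (H + p)               ≡⟨ cong (_+ (H + p)) (≈⇒≡ (CR.*-identityˡ w)) ⟩
        w + (H + p)                    ≡⟨ ≈⇒≡ (solve 3 (λ y p H → ((y :- p) :- H) :+ (H :+ p) := y) CR.refl y p H) ⟩
        y                              ∎
        where H = Rcs.offset ys
              w = (y - p) - H
      u*root : ∀ y ys p x xs → opP (node cs) (d , ds) p (x , xs) ≡ (y , ys) → u * x ≡ (y - p) - Rcs.offset ys
      u*root y ys p x xs e = trans
        (a+b≡c⇒a≡c-b _ _ _ (trans (sym (root-row σ _ x (roots cs xs) p (Rcs.roots-value ys x xs (,-injectiveʳ e)))) (,-injectiveˡ e)))
        (≈⇒≡ (solve 3 (λ y p H → y :- (H :+ p) := (y :- p) :- H) CR.refl y p (Rcs.offset ys)))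
      root-formula : ∀ y ys p x xs → opP (node cs) (d , ds) p (x , xs) ≡ (y , ys) → x ≡ g * (y - Rcs.offset ys) - g * p
      root-formula y ys p x xs e = trans (solve-linear u g x _ ug≡1 (u*root y ys p x xs e)) (distrib-g y p (Rcs.offset ys))

    allRegular⇒critical : ∀ σ → AllRegular cs ds σ → d ≡ σ → Critical (node cs) (d , ds)
    allRegular⇒critical σ Rcs refl = record
      { parentValue = λ { (y , ys) → y - Rcs.offset ys }
      ; solution = λ { (y , ys) s →
          let (xs , e , r) = Rcs.solution ys s
          in (s , xs) , cong₂ _,_
               (trans (cong (λ z → d * s + z + (y - Rcs.offset ys)) r)
                      (≈⇒≡ (solve 4 (λ d s H y → d :* s :+ (H :- d :* s) :+ (y :- H) := y) CR.refl d s (Rcs.offset ys) y)))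
               e , refl }
      ; forced = λ { (y , ys) p (x , xs) e → a+b≡c⇒a≡c-b p (Rcs.offset ys) y (trans
          (≈⇒≡ (solve 4 (λ d H x p → p :+ H := (d :- d) :* x :+ (H :+ p)) CR.refl d (Rcs.offset ys) x p))
          (trans (sym (root-row d _ x (roots cs xs) p (Rcs.roots-value ys x xs (,-injectiveʳ e)))) (,-injectiveˡ e))) }
      ; injective = λ { p (x , xs) (x' , xs') e x≡x' →
          cong₂ _,_ x≡x' (Rcs.injective x xs xs' (trans (,-injectiveʳ e) (cong (λ z → opF cs ds z xs') (sym x≡x')))) }
      }
      where module Rcs = AllRegular Rcs

    -- One critical child: the root value is forced and the root row fixes
    -- the sum of the children's roots, so the vertex is regular of gain 0.
    oneCritical⇒regular : OneCritical cs ds → Regular (node cs) (d , ds) 0#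
    oneCritical⇒regular Ocs = record
      { offset = λ { (y , ys) → Ocs.parentValue ys }
      ; solution = λ { (y , ys) p →
          let P = Ocs.parentValue ys ; (xs , e , r) = Ocs.solution ys ((y - p) - d * P)
          in (P , xs) , cong₂ _,_
               (trans (cong (λ z → d * P + z + p) r)
                      (≈⇒≡ (solve 3 (λ a y p → a :+ ((y :- p) :- a) :+ p := y) CR.refl (d * P) y p)))
               e , minus-0 P p }
      ; root-value = λ { (y , ys) p (x , xs) e → trans (Ocs.forced ys x xs (,-injectiveʳ e)) (minus-0 _ p) }
      ; injective = λ { p (x , xs) (x' , xs') e →
          let ys = opF cs ds x xs
              x≡x' = trans (Ocs.forced ys x xs refl) (sym (Ocs.forced ys x' xs' (sym (,-injectiveʳ e))))
              roots≡ = +-cancelˡ _ _ (d * x) (+-cancelʳ _ _ p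
                         (trans (,-injectiveˡ e) (cong (λ z → d * z + roots cs xs' + p) (sym x≡x'))))
          in cong₂ _,_ x≡x' (Ocs.injective x xs xs'
               (trans (,-injectiveʳ e) (cong (λ z → opF cs ds z xs') (sym x≡x'))) roots≡) }
      }
      where
      module Ocs = OneCritical Ocs
      minus-0 : ∀ a p → a ≡ a - 0# * p
      minus-0 a p = ≈⇒≡ (solve 2 (λ a p → a := a :- con (ℤ.+ 0) :* p) CR.refl a p)

    bad⇒degenerate : Bad cs ds → Degenerate (node cs) (d , ds)
    bad⇒degenerate (κs , e , r , κs≢0) = (0# , κs) ,
      cong₂ _,_ (trans (cong (λ z → d * 0# + z + 0#) r) (d*0+0+0≡0 d)) e , refl , λ e' → κs≢0 (,-injectiveʳ e')

    vertex-meaning : ∀ f → MeaningF cs ds f → Meaning (node cs) (d , ds) (vertexClass d f)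
    vertex-meaning (allRegular σ) m = from-gain (d ≟ σ)
      where
      from-gain : (d≟σ : Dec (d ≡ σ)) → Meaning (node cs) (d , ds) (vertexClassFromGain d σ d≟σ)
      from-gain (yes d≡σ) = allRegular⇒critical σ m d≡σ
      from-gain (no d≢σ)  = allRegular⇒regular σ _ m (inv-r (d - σ) (a≢b⇒a-b≢0 d≢σ))
    vertex-meaning oneCritical m = oneCritical⇒regular m
    vertex-meaning bad         m = bad⇒degenerate m

  noChildren : AllRegular [] tt 0#
  noChildren = record
    { offset = λ _ → 0#
    ; solution = λ _ p → tt , refl , 0≡0-0*p p
    ; roots-value = λ _ p _ _ → 0≡0-0*p p
    ; injective = λ _ _ _ _ → refl }
    where
    0≡0-0*p : ∀ p → 0# ≡ 0# - 0# * p
    0≡0-0*p p = ≈⇒≡ (solve 1 (λ p → con (ℤ.+ 0) := con (ℤ.+ 0) :- con (ℤ.+ 0) :* p) CR.refl p)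

  mutual
    meaning : ∀ R d → Meaning R d (classify R d)
    meaning (node cs) (d , ds) = vertex-meaning cs d ds (classifyF cs ds) (meaningF cs ds)

    meaningF : ∀ cs ds → MeaningF cs ds (classifyF cs ds)
    meaningF []       tt       = noChildren
    meaningF (c ∷ cs) (d , ds) = addChild-meaning c cs d ds (classify c d) (classifyF cs ds) (meaning c d) (meaningF cs ds)

-- Combinatorics of the preorder numbering: every vertex other than the
-- root is the second component of exactly one edge (its parent edge), and
-- edges point from smaller to larger numbers.
module PreorderEdges where
  open import Data.Bool.Properties using (T-≡)
  open import Function.Bundles using (Equivalence)

  size>0 : ∀ R → 0 < size R
  size>0 (node _) = s≤s z≤n

  memb : ℕ × ℕ → List (ℕ × ℕ) → Bool
  memb x       []             = false
  memb (a , k) ((u , v) ∷ E) = ((a ≡ᵇ u) ∧ (k ≡ᵇ v)) ∨ memb (a , k) E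

  ≡ᵇ-refl : ∀ n → (n ≡ᵇ n) ≡ true
  ≡ᵇ-refl n = Equivalence.to T-≡ (ℕP.≡⇒≡ᵇ n n refl)

  ≡ᵇ⇒≡ : ∀ m n → (m ≡ᵇ n) ≡ true → m ≡ n
  ≡ᵇ⇒≡ m n e = ℕP.≡ᵇ⇒≡ m n (Equivalence.from T-≡ e)

  memb-complete : ∀ x E → x ∈ E → memb x E ≡ true
  memb-complete (a , k) ((.a , .k) ∷ E) (here refl) rewrite ≡ᵇ-refl a | ≡ᵇ-refl k = refl
  memb-complete (a , k) ((u , v) ∷ E) (there x∈E) rewrite memb-complete (a , k) E x∈E
    with (a ≡ᵇ u) ∧ (k ≡ᵇ v)
  ... | true  = refl
  ... | false = refl

  memb-sound : ∀ x E → memb x E ≡ true → x ∈ E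
  memb-sound (a , k) ((u , v) ∷ E) e with a ≡ᵇ u in a≡u | k ≡ᵇ v in k≡v
  ... | true  | true rewrite ≡ᵇ⇒≡ a u a≡u | ≡ᵇ⇒≡ k v k≡v = here refl
  ... | true  | false = there (memb-sound (a , k) E e)
  ... | false | _     = there (memb-sound (a , k) E e)

  ∈?≡memb : ∀ x E → ⌊ x ∈? E ⌋ ≡ memb x E
  ∈?≡memb x E with x ∈? E
  ... | yes x∈E = sym (memb-complete x E x∈E)
  ... | no x∉E with memb x E in e
  ...   | true  = ⊥-elim (x∉E (memb-sound x E e))
  ...   | false = refl

  Bounded : ℕ → ℕ → ℕ → ℕ × ℕ → Set
  Bounded lo slo hi (u , v) = lo ≤ u × u < v × slo ≤ v × v < hi

  DistinctChild : ℕ × ℕ → ℕ × ℕ → Set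
  DistinctChild e e' = ¬ proj₂ e ≡ proj₂ e'

  mutual
    edges-bounded : ∀ k R → All (Bounded k (suc k) (k ℕ.+ size R)) (edges k R)
    edges-bounded k (node cs) = All.map (λ {e} → weaken e) (edgesCh-bounded k (suc k) cs (ℕP.n<1+n k))
      where
      weaken : ∀ e → Bounded k (suc k) (suc k ℕ.+ sizes cs) e → Bounded k (suc k) (k ℕ.+ suc (sizes cs)) e
      weaken (u , v) (a , b , c , d) = a , b , c , subst (v <_) (sym (ℕP.+-suc k (sizes cs))) d

    edgesCh-bounded : ∀ p o cs → p < o → All (Bounded p o (o ℕ.+ sizes cs)) (edgesCh p o cs)
    edgesCh-bounded p o []       p<o = []
    edgesCh-bounded p o (c ∷ cs) p<o =
      (ℕP.≤-refl , p<o , ℕP.≤-refl , ℕP.m<m+n o (ℕP.<-≤-trans (size>0 c) (ℕP.m≤m+n (size c) (sizes cs))))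
      ∷ AllP.++⁺ (All.map (λ {e} → weaken₁ e) (edges-bounded o c))
                 (All.map (λ {e} → weaken₂ e) (edgesCh-bounded p (o ℕ.+ size c) cs (ℕP.<-≤-trans p<o (ℕP.m≤m+n o (size c)))))
      where
      weaken₁ : ∀ e → Bounded o (suc o) (o ℕ.+ size c) e → Bounded p o (o ℕ.+ (size c ℕ.+ sizes cs)) e
      weaken₁ (u , v) (a , b , c' , d) = ℕP.≤-trans (ℕP.<⇒≤ p<o) a , b , ℕP.<⇒≤ c' ,
        ℕP.<-≤-trans d (ℕP.≤-trans (ℕP.m≤m+n (o ℕ.+ size c) (sizes cs)) (ℕP.≤-reflexive (ℕP.+-assoc o (size c) (sizes cs))))
      weaken₂ : ∀ e → Bounded p (o ℕ.+ size c) (o ℕ.+ size c ℕ.+ sizes cs) e → Bounded p o (o ℕ.+ (size c ℕ.+ sizes cs)) e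
      weaken₂ (u , v) (a , b , c' , d) = a , b , ℕP.≤-trans (ℕP.m≤m+n o (size c)) c' ,
        subst (v <_) (ℕP.+-assoc o (size c) (sizes cs)) d

  mutual
    edges-distinct : ∀ k R → AllPairs DistinctChild (edges k R)
    edges-distinct k (node cs) = edgesCh-distinct k (suc k) cs (ℕP.n<1+n k)

    edgesCh-distinct : ∀ p o cs → p < o → AllPairs DistinctChild (edgesCh p o cs)
    edgesCh-distinct p o []       p<o = []
    edgesCh-distinct p o (c ∷ cs) p<o =
      AllP.++⁺ (All.map (λ {e} → below-first e) (edges-bounded o c))
               (All.map (λ {e} → after-first e) (edgesCh-bounded p o' cs p<o'))
      ∷ AllPairsP.++⁺ (edges-distinct o c) (edgesCh-distinct p o' cs p<o')
          (All.map (λ {e} b → All.map (λ {e'} → disjoint e e' b) (edgesCh-bounded p o' cs p<o')) (edges-bounded o c))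
      where
      o' = o ℕ.+ size c
      p<o' : p < o'
      p<o' = ℕP.<-≤-trans p<o (ℕP.m≤m+n o (size c))
      below-first : ∀ e → Bounded o (suc o) o' e → DistinctChild (p , o) e
      below-first (u , v) (_ , _ , o<v , _) o≡v = ℕP.<-irrefl o≡v o<v
      after-first : ∀ e → Bounded p o' (o' ℕ.+ sizes cs) e → DistinctChild (p , o) e
      after-first (u , v) (_ , _ , o'≤v , _) o≡v = ℕP.<-irrefl o≡v (ℕP.<-≤-trans (ℕP.m<m+n o (size>0 c)) o'≤v)
      disjoint : ∀ e e' → Bounded o (suc o) o' e → Bounded p o' (o' ℕ.+ sizes cs) e' → DistinctChild e e'
      disjoint (u , v) (u' , v') (_ , _ , _ , v<o') (_ , _ , o'≤v' , _) v≡v' = ℕP.<-irrefl v≡v' (ℕP.<-≤-trans v<o' o'≤v')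

module Flattening {q : ℕ} (F : FiniteField q) where
  open Arithmetic F
  open TreeVectors F

  -- entry R x m: the entry of x at the vertex numbered m (0 if m ≥ size R).
  mutual
    entry : ∀ R → V R → ℕ → Carrier
    entry (node cs) (x , xs) zero    = x
    entry (node cs) (x , xs) (suc m) = entries cs xs m

    entries : ∀ cs → Vs cs → ℕ → Carrier
    entries []       _        m = 0#
    entries (c ∷ cs) (x , xs) m = entries-split c cs x xs m (m <? size c)

    entries-split : ∀ c cs → V c → Vs cs → (m : ℕ) → Dec (m < size c) → Carrier
    entries-split c cs x xs m (yes _) = entry c x m
    entries-split c cs x xs m (no _)  = entries cs xs (m ∸ size c)

  entries-first : ∀ c cs x xs m → m < size c → entries (c ∷ cs) (x , xs) m ≡ entry c x m
  entries-first c cs x xs m m<c with m <? size c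
  ... | yes _   = refl
  ... | no m≮c = ⊥-elim (m≮c m<c)

  entries-rest : ∀ c cs x xs m → ¬ m < size c → entries (c ∷ cs) (x , xs) m ≡ entries cs xs (m ∸ size c)
  entries-rest c cs x xs m m≮c with m <? size c
  ... | yes m<c = ⊥-elim (m≮c m<c)
  ... | no _    = refl

  entries-shift : ∀ c cs x xs m → entries (c ∷ cs) (x , xs) (size c ℕ.+ m) ≡ entries cs xs m
  entries-shift c cs x xs m =
    trans (entries-rest c cs x xs (size c ℕ.+ m) (ℕP.≤⇒≯ (ℕP.m≤m+n (size c) m)))
          (cong (entries cs xs) (ℕP.m+n∸m≡n (size c) m))

  mutual
    entry-beyond : ∀ R x m → size R ≤ m → entry R x m ≡ 0#
    entry-beyond (node cs) (x , xs) (suc m) (s≤s le) = entries-beyond cs xs m le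

    entries-beyond : ∀ cs xs m → sizes cs ≤ m → entries cs xs m ≡ 0#
    entries-beyond []       xs       m le = refl
    entries-beyond (c ∷ cs) (x , xs) m le =
      trans (entries-rest c cs x xs m (ℕP.≤⇒≯ (ℕP.≤-trans (ℕP.m≤m+n (size c) (sizes cs)) le)))
            (entries-beyond cs xs (m ∸ size c)
              (subst (_≤ m ∸ size c) (ℕP.m+n∸m≡n (size c) (sizes cs)) (ℕP.∸-monoˡ-≤ (size c) le)))

  mutual
    entry-0V : ∀ R m → entry R (0V R) m ≡ 0#
    entry-0V (node cs) zero    = refl
    entry-0V (node cs) (suc m) = entries-0Vs cs m

    entries-0Vs : ∀ cs m → entries cs (0Vs cs) m ≡ 0#
    entries-0Vs []       m = refl
    entries-0Vs (c ∷ cs) m with m <? size c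
    ... | yes _ = entry-0V c m
    ... | no _  = entries-0Vs cs (m ∸ size c)

  mutual
    flat : ∀ R → V R → Vec Carrier (size R)
    flat (node cs) (x , xs) = x ∷ flats cs xs

    flats : ∀ cs → Vs cs → Vec Carrier (sizes cs)
    flats []       _        = []
    flats (c ∷ cs) (x , xs) = flat c x Vec.++ flats cs xs

  mutual
    unflat : ∀ R → Vec Carrier (size R) → V R
    unflat (node cs) (a ∷ v) = a , unflats cs v

    unflats : ∀ cs → Vec Carrier (sizes cs) → Vs cs
    unflats []       _ = tt
    unflats (c ∷ cs) v = unflat c (take (size c) v) , unflats cs (drop (size c) v)

  mutual
    flat∘unflat : ∀ R v → flat R (unflat R v) ≡ v
    flat∘unflat (node cs) (a ∷ v) = cong (a ∷_) (flats∘unflats cs v)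

    flats∘unflats : ∀ cs v → flats cs (unflats cs v) ≡ v
    flats∘unflats []       []  = refl
    flats∘unflats (c ∷ cs) v = trans (cong₂ Vec._++_ (flat∘unflat c _) (flats∘unflats cs _)) (VecP.take++drop≡id (size c) v)

  mutual
    unflat∘flat : ∀ R x → unflat R (flat R x) ≡ x
    unflat∘flat (node cs) (x , xs) = cong (x ,_) (unflats∘flats cs xs)

    unflats∘flats : ∀ cs xs → unflats cs (flats cs xs) ≡ xs
    unflats∘flats []       tt       = refl
    unflats∘flats (c ∷ cs) (x , xs) = cong₂ _,_
      (trans (cong (unflat c) (VecP.++-injectiveˡ (take (size c) v) (flat c x) split)) (unflat∘flat c x))
      (trans (cong (unflats cs) (VecP.++-injectiveʳ (take (size c) v) (flat c x) split)) (unflats∘flats cs xs))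
      where
      v = flat c x Vec.++ flats cs xs
      split = VecP.take++drop≡id (size c) v

  private
    toℕ-reduce≥ : ∀ m {n} (i : Fin (m ℕ.+ n)) (m≤i : m ≤ toℕ i) → toℕ (Fin.reduce≥ i m≤i) ≡ toℕ i ∸ m
    toℕ-reduce≥ zero    i       m≤i       = refl
    toℕ-reduce≥ (suc m) (suc i) (s≤s m≤i) = toℕ-reduce≥ m i m≤i

  mutual
    lookup-flat : ∀ R x (i : Fin (size R)) → lookup (flat R x) i ≡ entry R x (toℕ i)
    lookup-flat (node cs) (x , xs) zero    = refl
    lookup-flat (node cs) (x , xs) (suc i) = lookup-flats cs xs i

    lookup-flats : ∀ cs xs (i : Fin (sizes cs)) → lookup (flats cs xs) i ≡ entries cs xs (toℕ i)
    lookup-flats (c ∷ cs) (x , xs) i with toℕ i <? size c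
    ... | yes i<c = trans (VecP.lookup-++-< (flat c x) (flats cs xs) i i<c)
                    (trans (lookup-flat c x (Fin.fromℕ< i<c)) (cong (entry c x) (FinP.toℕ-fromℕ< i<c)))
    ... | no i≮c = trans (VecP.lookup-++-≥ (flat c x) (flats cs xs) i c≤i)
                    (trans (lookup-flats cs xs (Fin.reduce≥ i c≤i)) (cong (entries cs xs) (toℕ-reduce≥ (size c) i c≤i)))
      where c≤i = ℕP.≮⇒≥ i≮c

  lookup-unflat : ∀ R v (i : Fin (size R)) → lookup v i ≡ entry R (unflat R v) (toℕ i)
  lookup-unflat R v i = trans (cong (λ w → lookup w i) (sym (flat∘unflat R v))) (lookup-flat R (unflat R v) i)

  entry-ext : ∀ R x y → (∀ (i : Fin (size R)) → entry R x (toℕ i) ≡ entry R y (toℕ i)) → x ≡ y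
  entry-ext R x y e = begin
    x                                   ≡⟨ sym (unflat∘flat R x) ⟩
    unflat R (flat R x)                 ≡⟨ cong (unflat R) flat≡ ⟩
    unflat R (flat R y)                 ≡⟨ unflat∘flat R y ⟩
    y                                   ∎
    where
    open ≡-Reasoning
    flat≡ : flat R x ≡ flat R y
    flat≡ = trans (sym (VecP.tabulate∘lookup (flat R x)))
              (trans (VecP.tabulate-cong (λ i → trans (lookup-flat R x i) (trans (e i) (sym (lookup-flat R y i)))))
                     (VecP.tabulate∘lookup (flat R y)))

module NeighbourSums {q : ℕ} (F : FiniteField q) where
  open Arithmetic F
  open TreeVectors F
  open Flattening F
  open PreorderEdges using (size>0; ≡ᵇ-refl; ≡ᵇ⇒≡; memb; memb-sound; DistinctChild)
  open MatrixFacts F using (sum; sum-cong; sum-+; sum-*ˡ)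
  open import Data.Bool.Properties using (∨-zeroʳ; ∧-conicalˡ; ∧-conicalʳ; ¬-not)
  open ≡-Reasoning

  ind : Bool → Carrier
  ind b = if b then 1# else 0#

  ≡ᵇ-≢ : ∀ a b → ¬ a ≡ b → (a ≡ᵇ b) ≡ false
  ≡ᵇ-≢ zero    zero    a≢b = ⊥-elim (a≢b refl)
  ≡ᵇ-≢ zero    (suc b) a≢b = refl
  ≡ᵇ-≢ (suc a) zero    a≢b = refl
  ≡ᵇ-≢ (suc a) (suc b) a≢b = ≡ᵇ-≢ a b (λ e → a≢b (cong suc e))

  ≡ᵇ-shift : ∀ o m → ((o ℕ.+ m) ≡ᵇ o) ≡ (m ≡ᵇ 0)
  ≡ᵇ-shift zero    m = refl
  ≡ᵇ-shift (suc o) m = ≡ᵇ-shift o m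

  ind-≢ : ∀ {a b} → ¬ a ≡ b → ∀ x → ind (a ≡ᵇ b) * x ≡ 0#
  ind-≢ {a} {b} a≢b x = trans (cong (λ t → ind t * x) (≡ᵇ-≢ a b a≢b)) (≈⇒≡ (CR.zeroˡ x))

  ind-refl : ∀ a x → ind (a ≡ᵇ a) * x ≡ x
  ind-refl a x = trans (cong (λ t → ind t * x) (≡ᵇ-refl a)) (≈⇒≡ (CR.*-identityˡ x))

  neighbourSum : List (ℕ × ℕ) → ℕ → (ℕ → Carrier) → Carrier
  neighbourSum []             a w = 0#
  neighbourSum ((u , v) ∷ E) a w = (ind (a ≡ᵇ u) * w v + ind (a ≡ᵇ v) * w u) + neighbourSum E a w

  neighbourSum-++ : ∀ E₁ E₂ a w → neighbourSum (E₁ ++ E₂) a w ≡ neighbourSum E₁ a w + neighbourSum E₂ a w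
  neighbourSum-++ []              E₂ a w = sym (+-identityˡ _)
  neighbourSum-++ ((u , v) ∷ E₁) E₂ a w =
    trans (cong (_ +_) (neighbourSum-++ E₁ E₂ a w)) (sym (≈⇒≡ (CR.+-assoc _ _ _)))

  mutual
    adj : ∀ R → V R → V R
    adj (node cs) (x , xs) = roots cs xs , adjF cs x xs

    adjF : ∀ cs → Carrier → Vs cs → Vs cs
    adjF []       p _        = tt
    adjF (c ∷ cs) p (x , xs) = addToRoot c (adj c x) p , adjF cs p xs

  entry-addToRoot : ∀ R v p m → entry R (addToRoot R v p) m ≡ entry R v m + ind (m ≡ᵇ 0) * p
  entry-addToRoot (node cs) (x , xs) p zero    = cong (x +_) (sym (≈⇒≡ (CR.*-identityˡ p)))
  entry-addToRoot (node cs) (x , xs) p (suc m) = sym (trans (cong (entries cs xs m +_) (≈⇒≡ (CR.zeroˡ p))) (+-identityʳ _))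

  mutual
    entry-op : ∀ R d x m → entry R (op R d x) m ≡ entry R d m * entry R x m + entry R (adj R x) m
    entry-op (node cs) (d , ds) (x , xs) zero    = refl
    entry-op (node cs) (d , ds) (x , xs) (suc m) = entries-opF cs ds x xs m

    entries-opF : ∀ cs ds p xs m → entries cs (opF cs ds p xs) m ≡ entries cs ds m * entries cs xs m + entries cs (adjF cs p xs) m
    entries-opF []       ds       p xs       m = sym (trans (+-identityʳ _) (≈⇒≡ (CR.zeroˡ 0#)))
    entries-opF (c ∷ cs) (d , ds) p (x , xs) m with m <? size c
    ... | yes _ = begin
      entry c (addToRoot c (op c d x) p) m                         ≡⟨ entry-addToRoot c (op c d x) p m ⟩
      entry c (op c d x) m + ind (m ≡ᵇ 0) * p                      ≡⟨ cong (_+ ind (m ≡ᵇ 0) * p) (entry-op c d x m) ⟩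
      entry c d m * entry c x m + entry c (adj c x) m + ind (m ≡ᵇ 0) * p ≡⟨ ≈⇒≡ (CR.+-assoc _ _ _) ⟩
      entry c d m * entry c x m + (entry c (adj c x) m + ind (m ≡ᵇ 0) * p)
        ≡⟨ cong (entry c d m * entry c x m +_) (sym (entry-addToRoot c (adj c x) p m)) ⟩
      entry c d m * entry c x m + entry c (addToRoot c (adj c x) p) m ∎
    ... | no _ = entries-opF cs ds p xs (m ∸ size c)

  Agrees : ℕ → (R : RTree) → V R → (ℕ → Carrier) → Set
  Agrees k R x w = ∀ m → m < size R → w (k ℕ.+ m) ≡ entry R x m

  AgreesF : ℕ → (cs : List RTree) → Vs cs → (ℕ → Carrier) → Set
  AgreesF o cs xs w = ∀ m → m < sizes cs → w (o ℕ.+ m) ≡ entries cs xs m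

  agrees-head : ∀ o c cs x xs w → AgreesF o (c ∷ cs) (x , xs) w → Agrees o c x w
  agrees-head o c cs x xs w ag m m<c = trans (ag m (ℕP.<-≤-trans m<c (ℕP.m≤m+n (size c) (sizes cs)))) (entries-first c cs x xs m m<c)

  agrees-tail : ∀ o c cs x xs w → AgreesF o (c ∷ cs) (x , xs) w → AgreesF (o ℕ.+ size c) cs xs w
  agrees-tail o c cs x xs w ag m m<cs = trans (cong w (ℕP.+-assoc o (size c) m))
    (trans (ag (size c ℕ.+ m) (ℕP.+-monoʳ-< (size c) m<cs)) (entries-shift c cs x xs m))

  agrees-children : ∀ k cs x xs w → Agrees k (node cs) (x , xs) w → AgreesF (suc k) cs xs w
  agrees-children k cs x xs w ag m m<cs = trans (cong w (sym (ℕP.+-suc k m))) (ag (suc m) (s≤s m<cs))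

  mutual
    neighbourSum-before : ∀ k R w a → a < k → neighbourSum (edges k R) a w ≡ 0#
    neighbourSum-before k (node cs) w a a<k = neighbourSumCh-before k (suc k) cs w a (ℕP.m<n⇒m<1+n a<k) (ℕP.<⇒≢ a<k)

    neighbourSumCh-before : ∀ p o cs w a → a < o → ¬ a ≡ p → neighbourSum (edgesCh p o cs) a w ≡ 0#
    neighbourSumCh-before p o []       w a a<o a≢p = refl
    neighbourSumCh-before p o (c ∷ cs) w a a<o a≢p = begin
      (ind (a ≡ᵇ p) * w o + ind (a ≡ᵇ o) * w p) + neighbourSum (edges o c ++ edgesCh p (o ℕ.+ size c) cs) a w
        ≡⟨ cong₂ _+_ (cong₂ _+_ (ind-≢ a≢p (w o)) (ind-≢ (ℕP.<⇒≢ a<o) (w p))) (neighbourSum-++ (edges o c) _ a w) ⟩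
      (0# + 0#) + (neighbourSum (edges o c) a w + neighbourSum (edgesCh p (o ℕ.+ size c) cs) a w)
        ≡⟨ cong ((0# + 0#) +_) (cong₂ _+_ (neighbourSum-before o c w a a<o)
             (neighbourSumCh-before p (o ℕ.+ size c) cs w a (ℕP.<-≤-trans a<o (ℕP.m≤m+n o (size c))) a≢p)) ⟩
      (0# + 0#) + (0# + 0#) ≡⟨ trans (cong₂ _+_ (+-identityˡ 0#) (+-identityˡ 0#)) (+-identityˡ 0#) ⟩
      0# ∎

  neighbourSumCh-parent : ∀ p o cs xs w → AgreesF o cs xs w → p < o → neighbourSum (edgesCh p o cs) p w ≡ roots cs xs
  neighbourSumCh-parent p o []       xs       w ag p<o = refl
  neighbourSumCh-parent p o (c ∷ cs) (x , xs) w ag p<o = begin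
    (ind (p ≡ᵇ p) * w o + ind (p ≡ᵇ o) * w p) + neighbourSum (edges o c ++ edgesCh p (o ℕ.+ size c) cs) p w
      ≡⟨ cong₂ _+_ (cong₂ _+_ (ind-refl p (w o)) (ind-≢ (ℕP.<⇒≢ p<o) (w p))) (neighbourSum-++ (edges o c) _ p w) ⟩
    (w o + 0#) + (neighbourSum (edges o c) p w + neighbourSum (edgesCh p (o ℕ.+ size c) cs) p w)
      ≡⟨ cong₂ _+_ (trans (+-identityʳ (w o)) w-o) (trans (cong₂ _+_ (neighbourSum-before o c w p p<o)
           (neighbourSumCh-parent p (o ℕ.+ size c) cs xs w (agrees-tail o c cs x xs w ag) (ℕP.<-≤-trans p<o (ℕP.m≤m+n o (size c)))))
           (+-identityˡ _)) ⟩
    root c x + roots cs xs ∎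
    where
    w-o : w o ≡ root c x
    w-o = trans (cong w (sym (ℕP.+-identityʳ o))) (trans (agrees-head o c cs x xs w ag 0 (size>0 c)) (root-entry c x))
      where
      root-entry : ∀ R x → entry R x 0 ≡ root R x
      root-entry (node cs) x = refl

  mutual
    neighbourSum-inside : ∀ k R x w → Agrees k R x w → ∀ m → neighbourSum (edges k R) (k ℕ.+ m) w ≡ entry R (adj R x) m
    neighbourSum-inside k (node cs) (x , xs) w ag zero =
      trans (cong (λ a → neighbourSum (edgesCh k (suc k) cs) a w) (ℕP.+-identityʳ k))
            (neighbourSumCh-parent k (suc k) cs xs w (agrees-children k cs x xs w ag) (ℕP.n<1+n k))
    neighbourSum-inside k (node cs) (x , xs) w ag (suc m) =
      trans (cong (λ a → neighbourSum (edgesCh k (suc k) cs) a w) (ℕP.+-suc k m))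
        (trans (neighbourSumCh-inside k (suc k) cs xs w (agrees-children k cs x xs w ag) (ℕP.n<1+n k) m)
               (cong (λ t → entries cs (adjF cs t xs) m) w-k))
      where
      w-k : w k ≡ x
      w-k = trans (cong w (sym (ℕP.+-identityʳ k))) (ag 0 (s≤s z≤n))

    neighbourSumCh-inside : ∀ p o cs xs w → AgreesF o cs xs w → p < o → ∀ m →
      neighbourSum (edgesCh p o cs) (o ℕ.+ m) w ≡ entries cs (adjF cs (w p) xs) m
    neighbourSumCh-inside p o []       xs       w ag p<o m = refl
    neighbourSumCh-inside p o (c ∷ cs) (x , xs) w ag p<o m with m <? size c
    ... | yes m<c = begin
      (ind (a ≡ᵇ p) * w o + ind (a ≡ᵇ o) * w p) + neighbourSum (edges o c ++ rest) a w
        ≡⟨ cong₂ _+_ (cong₂ _+_ (ind-≢ a≢p (w o)) (cong (λ t → ind t * w p) (≡ᵇ-shift o m))) (neighbourSum-++ (edges o c) _ a w) ⟩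
      (0# + ind (m ≡ᵇ 0) * w p) + (neighbourSum (edges o c) a w + neighbourSum rest a w)
        ≡⟨ cong₂ _+_ (+-identityˡ _) (cong₂ _+_ (neighbourSum-inside o c x w (agrees-head o c cs x xs w ag) m)
             (neighbourSumCh-before p (o ℕ.+ size c) cs w a (ℕP.+-monoʳ-< o m<c) a≢p)) ⟩
      ind (m ≡ᵇ 0) * w p + (entry c (adj c x) m + 0#)
        ≡⟨ trans (cong (_ +_) (+-identityʳ _)) (≈⇒≡ (CR.+-comm _ _)) ⟩
      entry c (adj c x) m + ind (m ≡ᵇ 0) * w p ≡⟨ sym (entry-addToRoot c (adj c x) (w p) m) ⟩
      entry c (addToRoot c (adj c x) (w p)) m ∎
      where
      a = o ℕ.+ m
      rest = edgesCh p (o ℕ.+ size c) cs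
      a≢p : ¬ a ≡ p
      a≢p a≡p = ℕP.<-irrefl (sym a≡p) (ℕP.<-≤-trans p<o (ℕP.m≤m+n o m))
    ... | no m≮c = begin
      (ind (a ≡ᵇ p) * w o + ind (a ≡ᵇ o) * w p) + neighbourSum (edges o c ++ rest) a w
        ≡⟨ cong₂ _+_ (cong₂ _+_ (ind-≢ a≢p (w o)) (ind-≢ a≢o (w p))) (neighbourSum-++ (edges o c) _ a w) ⟩
      (0# + 0#) + (neighbourSum (edges o c) a w + neighbourSum rest a w)
        ≡⟨ cong₂ _+_ (+-identityˡ 0#) (cong₂ _+_
             (trans (neighbourSum-inside o c x w (agrees-head o c cs x xs w ag) m) (entry-beyond c (adj c x) m c≤m))
             (trans (cong (λ b → neighbourSum rest b w) a≡o'+m')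
                    (neighbourSumCh-inside p (o ℕ.+ size c) cs xs w (agrees-tail o c cs x xs w ag)
                      (ℕP.<-≤-trans p<o (ℕP.m≤m+n o (size c))) (m ∸ size c)))) ⟩
      0# + (0# + entries cs (adjF cs (w p) xs) (m ∸ size c)) ≡⟨ trans (+-identityˡ _) (+-identityˡ _) ⟩
      entries cs (adjF cs (w p) xs) (m ∸ size c) ∎
      where
      a = o ℕ.+ m
      rest = edgesCh p (o ℕ.+ size c) cs
      c≤m : size c ≤ m
      c≤m = ℕP.≮⇒≥ m≮c
      a≢p : ¬ a ≡ p
      a≢p a≡p = ℕP.<-irrefl (sym a≡p) (ℕP.<-≤-trans p<o (ℕP.m≤m+n o m))
      a≢o : ¬ a ≡ o
      a≢o a≡o = ℕP.<-irrefl (sym (ℕP.+-cancelˡ-≡ o m 0 (trans a≡o (sym (ℕP.+-identityʳ o))))) (ℕP.<-≤-trans (size>0 c) c≤m)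
      a≡o'+m' : a ≡ o ℕ.+ size c ℕ.+ (m ∸ size c)
      a≡o'+m' = trans (cong (o ℕ.+_) (sym (ℕP.m+[n∸m]≡n c≤m))) (sym (ℕP.+-assoc o (size c) (m ∸ size c)))

  sum-ind : ∀ n v (w : ℕ → Carrier) → v < n → sum n (λ k → ind (toℕ k ≡ᵇ v) * w (toℕ k)) ≡ w v
  sum-ind (suc n) zero    w _ = trans (cong₂ _+_ (≈⇒≡ (CR.*-identityˡ (w 0))) zeros) (+-identityʳ _)
    where
    zeros : sum n (λ k → 0# * w (suc (toℕ k))) ≡ 0#
    zeros = trans (sum-*ˡ n 0# _) (≈⇒≡ (CR.zeroˡ _))
  sum-ind (suc n) (suc v) w (s≤s v<n) =
    trans (cong₂ _+_ (≈⇒≡ (CR.zeroˡ (w 0))) (sum-ind n v (w ∘ suc) v<n)) (+-identityˡ _)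

  ind-∧ : ∀ x y → ind (x ∧ y) ≡ ind x * ind y
  ind-∧ true  y = sym (≈⇒≡ (CR.*-identityˡ _))
  ind-∧ false y = sym (≈⇒≡ (CR.zeroˡ _))

  ind-exclusive : ∀ b₁ b₂ r₁ r₂ → (b₁ ≡ true → b₂ ≡ false × (r₁ ∨ r₂) ≡ false) → (b₂ ≡ true → (r₁ ∨ r₂) ≡ false) →
    ind ((b₁ ∨ r₁) ∨ (b₂ ∨ r₂)) ≡ ind b₁ + ind b₂ + ind (r₁ ∨ r₂)
  ind-exclusive true  b₂ r₁ r₂ h₁ h₂ with h₁ refl
  ... | refl , r≡false rewrite r≡false = sym (trans (+-identityʳ _) (+-identityʳ 1#))
  ind-exclusive false true r₁ r₂ h₁ h₂ rewrite h₂ refl =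
    trans (cong ind (∨-zeroʳ r₁)) (sym (trans (+-identityʳ _) (+-identityˡ 1#)))
  ind-exclusive false false r₁ r₂ h₁ h₂ = sym (trans (cong (_+ ind (r₁ ∨ r₂)) (+-identityˡ 0#)) (+-identityˡ _))

  ∨-false : ∀ {x y} → x ≡ false → y ≡ false → (x ∨ y) ≡ false
  ∨-false refl refl = refl

  adjacency-row : ∀ n E → AllPairs DistinctChild E → All (λ e → proj₁ e < proj₂ e × proj₂ e < n) E → ∀ a w →
    sum n (λ k → ind (memb (a , toℕ k) E ∨ memb (toℕ k , a) E) * w (toℕ k)) ≡ neighbourSum E a w
  adjacency-row n [] _ _ a w = trans (sum-*ˡ n 0# _) (≈⇒≡ (CR.zeroˡ _))
  adjacency-row n ((u , v) ∷ E) (distinct ∷ E-distinct) ((u<v , v<n) ∷ E-bounded) a w = begin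
    sum n (λ k → ind (((a ≡ᵇ u) ∧ (K k ≡ᵇ v) ∨ memb (a , K k) E) ∨ ((K k ≡ᵇ u) ∧ (a ≡ᵇ v) ∨ memb (K k , a) E)) * w (K k))
      ≡⟨ sum-cong n (λ k → trans (cong (_* w (K k)) (ind-exclusive _ _ _ _ (forward (K k)) (backward (K k))))
                                 (≈⇒≡ (solve 4 (λ x y z t → (x :+ y :+ z) :* t := x :* t :+ y :* t :+ z :* t) CR.refl _ _ _ (w (K k))))) ⟩
    sum n (λ k → ind ((a ≡ᵇ u) ∧ (K k ≡ᵇ v)) * w (K k) + ind ((K k ≡ᵇ u) ∧ (a ≡ᵇ v)) * w (K k)
                 + ind (memb (a , K k) E ∨ memb (K k , a) E) * w (K k))
      ≡⟨ trans (sum-+ n _ _) (cong (_+ sum n (λ k → ind (memb (a , K k) E ∨ memb (K k , a) E) * w (K k))) (sum-+ n _ _)) ⟩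
    sum n (λ k → ind ((a ≡ᵇ u) ∧ (K k ≡ᵇ v)) * w (K k)) + sum n (λ k → ind ((K k ≡ᵇ u) ∧ (a ≡ᵇ v)) * w (K k))
      + sum n (λ k → ind (memb (a , K k) E ∨ memb (K k , a) E) * w (K k))
      ≡⟨ cong₂ _+_ (cong₂ _+_ to-v to-u) (adjacency-row n E E-distinct E-bounded a w) ⟩
    ind (a ≡ᵇ u) * w v + ind (a ≡ᵇ v) * w u + neighbourSum E a w ∎
    where
    K = toℕ
    to-v : sum n (λ k → ind ((a ≡ᵇ u) ∧ (K k ≡ᵇ v)) * w (K k)) ≡ ind (a ≡ᵇ u) * w v
    to-v = trans (sum-cong n (λ k → trans (cong (_* w (K k)) (ind-∧ (a ≡ᵇ u) (K k ≡ᵇ v))) (≈⇒≡ (CR.*-assoc _ _ _))))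
                 (trans (sum-*ˡ n _ _) (cong (ind (a ≡ᵇ u) *_) (sum-ind n v w v<n)))
    to-u : sum n (λ k → ind ((K k ≡ᵇ u) ∧ (a ≡ᵇ v)) * w (K k)) ≡ ind (a ≡ᵇ v) * w u
    to-u = trans (sum-cong n (λ k → trans (cong (_* w (K k)) (ind-∧ (K k ≡ᵇ u) (a ≡ᵇ v)))
                                        (≈⇒≡ (solve 3 (λ x y z → x :* y :* z := y :* (x :* z)) CR.refl _ _ (w (K k))))))
                 (trans (sum-*ˡ n _ _) (cong (ind (a ≡ᵇ v) *_) (sum-ind n u w (ℕP.<-trans u<v v<n))))
    -- (u , v) is the only edge with child end v, and (v , u) is no edge
    uv∉E : memb (u , v) E ≢ true
    uv∉E m = All.lookup distinct (memb-sound (u , v) E m) refl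
    vu∉E : memb (v , u) E ≢ true
    vu∉E m = ℕP.<-asym u<v (proj₁ (All.lookup E-bounded (memb-sound (v , u) E m)))
    forward : ∀ k → ((a ≡ᵇ u) ∧ (k ≡ᵇ v)) ≡ true → ((k ≡ᵇ u) ∧ (a ≡ᵇ v)) ≡ false × (memb (a , k) E ∨ memb (k , a) E) ≡ false
    forward k e with ≡ᵇ⇒≡ a u (∧-conicalˡ _ _ e) | ≡ᵇ⇒≡ k v (∧-conicalʳ _ _ e)
    ... | refl | refl = ¬-not (λ e' → ℕP.<-irrefl (sym (≡ᵇ⇒≡ k a (∧-conicalˡ _ _ e'))) u<v) , ∨-false (¬-not uv∉E) (¬-not vu∉E)
    backward : ∀ k → ((k ≡ᵇ u) ∧ (a ≡ᵇ v)) ≡ true → (memb (a , k) E ∨ memb (k , a) E) ≡ false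
    backward k e with ≡ᵇ⇒≡ k u (∧-conicalˡ _ _ e) | ≡ᵇ⇒≡ a v (∧-conicalʳ _ _ e)
    ... | refl | refl = ∨-false (¬-not vu∉E) (¬-not uv∉E)

module Invertibility {q : ℕ} (F : FiniteField q) where
  open Arithmetic F
  open Matrices F
  open MatrixFacts F
  open TreeVectors F
  open Elimination F
  open Flattening F
  open NeighbourSums F
  open PreorderEdges using (memb; ∈?≡memb; edges-distinct; edges-bounded)
  open ≡-Reasoning

  diag≡I* : ∀ {n} (D : Vec Carrier n) i j → diag D i j ≡ I i j * lookup D i
  diag≡I* D i j with ⌊ i Fin.≟ j ⌋
  ... | true  = sym (≈⇒≡ (CR.*-identityˡ _))
  ... | false = sym (≈⇒≡ (CR.zeroˡ _))

  adjacent≡memb : ∀ R (i j : Fin (size R)) →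
    adjacent R i j ≡ (memb (toℕ i , toℕ j) (edges 0 R) ∨ memb (toℕ j , toℕ i) (edges 0 R))
  adjacent≡memb R i j = cong₂ _∨_ (∈?≡memb (toℕ i , toℕ j) (edges 0 R)) (∈?≡memb (toℕ j , toℕ i) (edges 0 R))

  vec : ∀ R → V R → Fin (size R) → Carrier
  vec R x i = entry R x (toℕ i)

  schrodinger-acts-as-op : ∀ R (dv : Vec Carrier (size R)) (x : V R) (i : Fin (size R)) →
    (schrodinger R dv · vec R x) i ≡ entry R (op R (unflat R dv) x) (toℕ i)
  schrodinger-acts-as-op R dv x i = begin
    sum n (λ j → (adjMatrix R i j + diag dv i j) * w (toℕ j))
      ≡⟨ sum-cong n (λ j → ≈⇒≡ (CR.distribʳ _ _ _)) ⟩
    sum n (λ j → adjMatrix R i j * w (toℕ j) + diag dv i j * w (toℕ j))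
      ≡⟨ sum-+ n _ _ ⟩
    sum n (λ j → adjMatrix R i j * w (toℕ j)) + sum n (λ j → diag dv i j * w (toℕ j))
      ≡⟨ cong₂ _+_ adjacency-part diagonal-part ⟩
    entry R (adj R x) a + entry R d a * w a
      ≡⟨ trans (≈⇒≡ (CR.+-comm _ _)) (sym (entry-op R d x a)) ⟩
    entry R (op R d x) a ∎
    where
    n = size R
    a = toℕ i
    w = entry R x
    d = unflat R dv
    E = edges 0 R
    adjacency-part : sum n (λ j → adjMatrix R i j * w (toℕ j)) ≡ entry R (adj R x) a
    adjacency-part = begin
      sum n (λ j → adjMatrix R i j * w (toℕ j))
        ≡⟨ sum-cong n (λ j → cong (λ b → ind b * w (toℕ j)) (adjacent≡memb R i j)) ⟩
      sum n (λ j → ind (memb (a , toℕ j) E ∨ memb (toℕ j , a) E) * w (toℕ j))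
        ≡⟨ adjacency-row n E (edges-distinct 0 R)
             (All.map (λ { (_ , u<v , _ , v<n) → u<v , v<n }) (edges-bounded 0 R)) a w ⟩
      neighbourSum E a w
        ≡⟨ neighbourSum-inside 0 R x w (λ m _ → refl) a ⟩
      entry R (adj R x) a ∎
    diagonal-part : sum n (λ j → diag dv i j * w (toℕ j)) ≡ entry R d a * w a
    diagonal-part = begin
      sum n (λ j → diag dv i j * w (toℕ j))
        ≡⟨ sum-cong n (λ j → trans (cong (_* w (toℕ j)) (diag≡I* dv i j)) (≈⇒≡ (CR.*-assoc _ _ _))) ⟩
      sum n (λ j → I i j * (lookup dv i * w (toℕ j)))
        ≡⟨ sum-I n i (λ j → lookup dv i * w (toℕ j)) ⟩
      lookup dv i * w a
        ≡⟨ cong (_* w a) (lookup-unflat R dv i) ⟩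
      entry R d a * w a ∎

  isRegular : Class → Bool
  isRegular (regular _) = true
  isRegular critical    = false
  isRegular degenerate  = false

  opP-0 : ∀ R d x m → entry R (opP R d 0# x) m ≡ entry R (op R d x) m
  opP-0 R d x m = trans (entry-addToRoot R (op R d x) 0# m)
                        (trans (cong (entry R (op R d x) m +_) (≈⇒≡ (CR.zeroʳ _))) (+-identityʳ _))

  module _ (R : RTree) (dv : Vec Carrier (size R)) where
    private
      d = unflat R dv
      M = schrodinger R dv

      tree : (Fin (size R) → Carrier) → V R
      tree y = unflat R (tabulate y)

      vec-tree : ∀ y i → vec R (tree y) i ≡ y i
      vec-tree y i = trans (sym (lookup-unflat R (tabulate y) i)) (VecP.lookup∘tabulate y i)

      M·vec : ∀ x i → (M · vec R x) i ≡ entry R (opP R d 0# x) (toℕ i)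
      M·vec x i = trans (schrodinger-acts-as-op R dv x i) (sym (opP-0 R d x (toℕ i)))

    kernel⇒singular : (κ : V R) → opP R d 0# κ ≡ 0V R → ¬ κ ≡ 0V R → ¬ Invertible M
    kernel⇒singular κ e κ≢0 = singular-if-kernel M (vec R κ)
      (λ κ≡0 → κ≢0 (entry-ext R κ (0V R) (λ i → trans (κ≡0 i) (sym (entry-0V R (toℕ i))))))
      (λ i → trans (M·vec κ i) (trans (cong (λ z → entry R z (toℕ i)) e) (entry-0V R (toℕ i))))

    regular⇒invertible : ∀ g → Regular R d g → Invertible M
    regular⇒invertible g Rg = invertible-if-bijective M solution solves injective
      where
      module Rg = Regular Rg
      solution : (Fin (size R) → Carrier) → Fin (size R) → Carrier
      solution y = vec R (proj₁ (Rg.solution (tree y) 0#))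
      solves : ∀ y i → (M · solution y) i ≡ y i
      solves y i = trans (M·vec _ i)
        (trans (cong (λ z → entry R z (toℕ i)) (proj₁ (proj₂ (Rg.solution (tree y) 0#)))) (vec-tree y i))
      M·y : ∀ y i → (M · y) i ≡ entry R (opP R d 0# (tree y)) (toℕ i)
      M·y y i = trans (·-congʳ M (λ j → sym (vec-tree y j)) i) (M·vec (tree y) i)
      injective : ∀ v v' → (∀ i → (M · v) i ≡ (M · v') i) → ∀ i → v i ≡ v' i
      injective v v' e i = trans (sym (vec-tree v i)) (trans (cong (λ z → vec R z i) tree-v≡tree-v') (vec-tree v' i))
        where
        tree-v≡tree-v' : tree v ≡ tree v'
        tree-v≡tree-v' = Rg.injective 0# (tree v) (tree v')
          (entry-ext R _ _ (λ i → trans (sym (M·y v i)) (trans (e i) (M·y v' i))))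

    invertible⇔regular : Invertible M ⇔ T (isRegular (classify R d))
    invertible⇔regular = by-class (classify R d) (meaning R d)
      where
      by-class : ∀ k → Meaning R d k → Invertible M ⇔ T (isRegular k)
      by-class (regular g) m = mk⇔ (λ _ → tt) (λ _ → regular⇒invertible g m)
      by-class critical    m = let (κ , e , r) = critical-kernel R d m in
        mk⇔ (λ inv → ⊥-elim (kernel⇒singular κ e (root≡1⇒≢0V R κ r) inv)) (λ ())
      by-class degenerate (κ , e , _ , κ≢0) = mk⇔ (λ inv → ⊥-elim (kernel⇒singular κ e κ≢0 inv)) (λ ())

module Evaluation where
  open import Data.Integer using (+_; -[1+_]; _+_; _*_; _-_)

  eval-+ : ∀ f g z → eval (f +ₚ g) z ≡ eval f z + eval g z
  eval-+ []      g       z = sym (ℤP.+-identityˡ (eval g z))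
  eval-+ (x ∷ f) []      z = sym (ℤP.+-identityʳ _)
  eval-+ (x ∷ f) (y ∷ g) z = trans (cong (λ t → (x + y) + z * t) (eval-+ f g z)) (regroup x y z (eval f z) (eval g z))
    where
    regroup : ∀ x y z a b → (x + y) + z * (a + b) ≡ (x + z * a) + (y + z * b)
    regroup = solve-∀

  eval-· : ∀ c f z → eval (c ·ₚ f) z ≡ c * eval f z
  eval-· c []      z = sym (ℤP.*-zeroʳ c)
  eval-· c (x ∷ f) z = trans (cong (λ t → c * x + z * t) (eval-· c f z)) (regroup c x z (eval f z))
    where
    regroup : ∀ c x z a → c * x + z * (c * a) ≡ c * (x + z * a)
    regroup = solve-∀

  eval-* : ∀ f g z → eval (f *ₚ g) z ≡ eval f z * eval g z
  eval-* []      g z = refl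
  eval-* (x ∷ f) g z = trans (eval-+ (x ·ₚ g) (+ 0 ∷ (f *ₚ g)) z)
    (trans (cong₂ _+_ (eval-· x g z) (cong (λ t → + 0 + z * t) (eval-* f g z))) (regroup x z (eval f z) (eval g z)))
    where
    regroup : ∀ x z a b → x * b + (+ 0 + z * (a * b)) ≡ (x + z * a) * b
    regroup = solve-∀

  eval-1 : ∀ z → eval oneₚ z ≡ + 1
  eval-1 z = expanded z
    where
    expanded : ∀ z → + 1 + z * + 0 ≡ + 1
    expanded = solve-∀

  eval-q : ∀ z → eval qₚ z ≡ z
  eval-q z = expanded z
    where
    expanded : ∀ z → + 0 + z * (+ 1 + z * + 0) ≡ z
    expanded = solve-∀

  eval-q-1 : ∀ z → eval q-1ₚ z ≡ z - + 1
  eval-q-1 z = expanded z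
    where
    expanded : ∀ z → -[1+ 0 ] + z * (+ 1 + z * + 0) ≡ z - + 1
    expanded = solve-∀

  eval-S : ∀ R z → eval (S R) z ≡ (z - + 1) * eval (proj₁ (ab R)) z + z * eval (proj₂ (ab R)) z
  eval-S R z = trans (eval-+ (q-1ₚ *ₚ proj₁ (ab R)) (qₚ *ₚ proj₂ (ab R)) z)
    (cong₂ _+_ (trans (eval-* q-1ₚ a z) (cong (_* eval a z) (eval-q-1 z)))
               (trans (eval-* qₚ b z) (cong (_* eval b z) (eval-q z))))
    where
    a = proj₁ (ab R)
    b = proj₂ (ab R)

module Counts where
  open import Data.Integer using (_+_; _*_; _-_) renaming (+_ to pos)

  total : ∀ {A : Set} → (A → ℤ) → List A → ℤ
  total w []       = pos 0
  total w (x ∷ xs) = w x + total w xs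

  module _ {A : Set} where
    total-++ : ∀ (w : A → ℤ) xs ys → total w (xs ++ ys) ≡ total w xs + total w ys
    total-++ w []       ys = sym (ℤP.+-identityˡ _)
    total-++ w (x ∷ xs) ys = trans (cong (w x +_) (total-++ w xs ys)) (sym (ℤP.+-assoc (w x) _ _))

    total-cong : ∀ {w w' : A → ℤ} xs → (∀ x → w x ≡ w' x) → total w xs ≡ total w' xs
    total-cong []       e = refl
    total-cong (x ∷ xs) e = cong₂ _+_ (e x) (total-cong xs e)

    total-+ : ∀ (f g : A → ℤ) xs → total (λ x → f x + g x) xs ≡ total f xs + total g xs
    total-+ f g []       = refl
    total-+ f g (x ∷ xs) = trans (cong (f x + g x +_) (total-+ f g xs)) (regroup (f x) (g x) _ _)
      where
      regroup : ∀ a b c d → a + b + (c + d) ≡ a + c + (b + d)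
      regroup = solve-∀

    total-- : ∀ (f g : A → ℤ) xs → total (λ x → f x - g x) xs ≡ total f xs - total g xs
    total-- f g []       = refl
    total-- f g (x ∷ xs) = trans (cong (f x - g x +_) (total-- f g xs)) (regroup (f x) (g x) _ _)
      where
      regroup : ∀ a b c d → a - b + (c - d) ≡ a + c - (b + d)
      regroup = solve-∀

    total-*ˡ : ∀ c (f : A → ℤ) xs → total (λ x → c * f x) xs ≡ c * total f xs
    total-*ˡ c f []       = sym (ℤP.*-zeroʳ c)
    total-*ˡ c f (x ∷ xs) = trans (cong (c * f x +_) (total-*ˡ c f xs)) (sym (ℤP.*-distribˡ-+ c (f x) _))

    total-*ʳ : ∀ c (f : A → ℤ) xs → total (λ x → f x * c) xs ≡ total f xs * c
    total-*ʳ c f xs = trans (total-cong xs (λ x → ℤP.*-comm (f x) c)) (trans (total-*ˡ c f xs) (ℤP.*-comm c _))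

    total-0 : ∀ (xs : List A) → total (λ _ → pos 0) xs ≡ pos 0
    total-0 []       = refl
    total-0 (x ∷ xs) = trans (ℤP.+-identityˡ _) (total-0 xs)

    total-1 : ∀ (xs : List A) → total (λ _ → pos 1) xs ≡ pos (length xs)
    total-1 []       = refl
    total-1 (x ∷ xs) = trans (cong (pos 1 +_) (total-1 xs)) (sym (ℤP.pos-+ 1 (length xs)))

    total-map : ∀ {B : Set} (w : B → ℤ) (f : A → B) xs → total w (List.map f xs) ≡ total (w ∘ f) xs
    total-map w f []       = refl
    total-map w f (x ∷ xs) = cong (w (f x) +_) (total-map w f xs)

  module _ {A B : Set} where
    total-× : ∀ (w : A × B → ℤ) xs ys → total w (cartesianProduct xs ys) ≡ total (λ x → total (λ y → w (x , y)) ys) xs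
    total-× w []       ys = refl
    total-× w (x ∷ xs) ys = trans (total-++ w (List.map (x ,_) ys) _) (cong₂ _+_ (total-map w (x ,_) ys) (total-× w xs ys))

    total-swap : ∀ (f : A → B → ℤ) xs ys → total (λ x → total (f x) ys) xs ≡ total (λ y → total (λ x → f x y) xs) ys
    total-swap f []       ys = sym (total-0 ys)
    total-swap f (x ∷ xs) ys = trans (cong (total (f x) ys +_) (total-swap f xs ys)) (sym (total-+ (f x) _ ys))

  [_] : Bool → ℤ
  [ true ]  = pos 1
  [ false ] = pos 0

  length-filter : ∀ {A : Set} (f : A → Bool) xs → pos (length (List.filter (λ x → T? (f x)) xs)) ≡ total ([_] ∘ f) xs
  length-filter f []       = refl
  length-filter f (x ∷ xs) with f x
  ... | true  = trans (ℤP.pos-+ 1 _) (cong (pos 1 +_) (length-filter f xs))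
  ... | false = trans (length-filter f xs) (sym (ℤP.+-identityˡ _))

module Counting {q : ℕ} (F : FiniteField q) where
  open import Data.Integer using (_+_; _*_; _-_) renaming (+_ to pos)
  open Arithmetic F using (Carrier; _≟_)
  open FiniteField F using (card)
  open TreeVectors F
  open Elimination F
  open Invertibility F using (isRegular)
  open Evaluation
  open Counts
  open ≡-Reasoning

  elements : List Carrier
  elements = List.tabulate (Inverse.to card)

  elements-unique : Unique elements
  elements-unique = UniqueP.tabulate⁺ (λ {i} {j} e → trans (sym (Inverse.strictlyInverseʳ card i))
                      (trans (cong (Inverse.from card) e) (Inverse.strictlyInverseʳ card j)))

  elements-complete : ∀ x → x ∈ elements
  elements-complete x = subst (_∈ elements) (Inverse.strictlyInverseˡ card x) (∈P.∈-tabulate⁺ (Inverse.from card x))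

  Q : ℤ
  Q = pos q

  total-1-elements : total (λ _ → pos 1) elements ≡ Q
  total-1-elements = trans (total-1 elements) (cong pos (ListP.length-tabulate (Inverse.to card)))

  total-≟ : ∀ σ → total (λ x → [ ⌊ x ≟ σ ⌋ ]) elements ≡ pos 1
  total-≟ σ = once elements elements-unique (elements-complete σ)
    where
    never : ∀ xs → ¬ σ ∈ xs → total (λ x → [ ⌊ x ≟ σ ⌋ ]) xs ≡ pos 0
    never []       _   = refl
    never (x ∷ xs) σ∉ with x ≟ σ
    ... | yes x≡σ = ⊥-elim (σ∉ (here (sym x≡σ)))
    ... | no _    = trans (ℤP.+-identityˡ _) (never xs (λ m → σ∉ (there m)))
    once : ∀ xs → Unique xs → σ ∈ xs → total (λ x → [ ⌊ x ≟ σ ⌋ ]) xs ≡ pos 1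
    once (x ∷ xs) (x∉xs ∷ u) σ∈ with x ≟ σ | σ∈
    ... | yes refl | _          = cong (pos 1 +_) (never xs (λ m → All.lookup x∉xs m refl))
    ... | no x≢σ   | here σ≡x   = ⊥-elim (x≢σ (sym σ≡x))
    ... | no _     | there σ∈xs = trans (ℤP.+-identityˡ _) (once xs u σ∈xs)

  mutual
    allV : ∀ R → List (V R)
    allV (node cs) = cartesianProduct elements (allVs cs)

    allVs : ∀ cs → List (Vs cs)
    allVs []       = tt ∷ []
    allVs (c ∷ cs) = cartesianProduct (allV c) (allVs cs)

  mutual
    allV-complete : ∀ R x → x ∈ allV R
    allV-complete (node cs) (d , ds) = ∈P.∈-cartesianProduct⁺ (elements-complete d) (allVs-complete cs ds)

    allVs-complete : ∀ cs xs → xs ∈ allVs cs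
    allVs-complete []       tt       = here refl
    allVs-complete (c ∷ cs) (x , xs) = ∈P.∈-cartesianProduct⁺ (allV-complete c x) (allVs-complete cs xs)

  mutual
    allV-unique : ∀ R → Unique (allV R)
    allV-unique (node cs) = UniqueP.cartesianProduct⁺ elements-unique (allVs-unique cs)

    allVs-unique : ∀ cs → Unique (allVs cs)
    allVs-unique []       = [] ∷ []
    allVs-unique (c ∷ cs) = UniqueP.cartesianProduct⁺ (allV-unique c) (allVs-unique cs)

  isCritical : Class → Bool
  isCritical critical = true
  isCritical _        = false

  isAllRegular : ForestClass → Bool
  isAllRegular (allRegular _) = true
  isAllRegular _              = false

  isOneCritical : ForestClass → Bool
  isOneCritical oneCritical = true
  isOneCritical _           = false

  #regular #critical : RTree → ℤ
  #regular  R = total ([_] ∘ isRegular ∘ classify R) (allV R)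
  #critical R = total ([_] ∘ isCritical ∘ classify R) (allV R)

  #allRegular #oneCritical : List RTree → ℤ
  #allRegular  cs = total ([_] ∘ isAllRegular ∘ classifyF cs) (allVs cs)
  #oneCritical cs = total ([_] ∘ isOneCritical ∘ classifyF cs) (allVs cs)

  -- Over the q choices of the root value, given the class of the children:
  -- if all children are regular, all d ≠ σ give a regular vertex and d = σ
  -- a critical one; if exactly one child is critical, all q are regular.
  regular-root-values : ∀ f → total (λ d → [ isRegular (vertexClass d f) ]) elements
                              ≡ (Q - pos 1) * [ isAllRegular f ] + Q * [ isOneCritical f ]
  regular-root-values (allRegular σ) = begin
    total (λ d → [ isRegular (vertexClassFromGain d σ (d ≟ σ)) ]) elements ≡⟨ total-cong elements by-cases ⟩
    total (λ d → pos 1 - [ ⌊ d ≟ σ ⌋ ]) elements                          ≡⟨ total-- _ _ elements ⟩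
    total (λ _ → pos 1) elements - total (λ d → [ ⌊ d ≟ σ ⌋ ]) elements  ≡⟨ cong₂ _-_ total-1-elements (total-≟ σ) ⟩
    Q - pos 1                                                              ≡⟨ normalise Q ⟩
    (Q - pos 1) * pos 1 + Q * pos 0                                        ∎
    where
    by-cases : ∀ d → [ isRegular (vertexClassFromGain d σ (d ≟ σ)) ] ≡ pos 1 - [ ⌊ d ≟ σ ⌋ ]
    by-cases d with d ≟ σ
    ... | yes _ = refl
    ... | no _  = refl
    normalise : ∀ Q → Q - pos 1 ≡ (Q - pos 1) * pos 1 + Q * pos 0
    normalise = solve-∀
  regular-root-values oneCritical = trans total-1-elements (normalise Q)
    where
    normalise : ∀ Q → Q ≡ (Q - pos 1) * pos 0 + Q * pos 1
    normalise = solve-∀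
  regular-root-values bad = trans (total-0 elements) (normalise Q)
    where
    normalise : ∀ Q → pos 0 ≡ (Q - pos 1) * pos 0 + Q * pos 0
    normalise = solve-∀

  critical-root-values : ∀ f → total (λ d → [ isCritical (vertexClass d f) ]) elements ≡ [ isAllRegular f ]
  critical-root-values (allRegular σ) = trans (total-cong elements by-cases) (total-≟ σ)
    where
    by-cases : ∀ d → [ isCritical (vertexClassFromGain d σ (d ≟ σ)) ] ≡ [ ⌊ d ≟ σ ⌋ ]
    by-cases d with d ≟ σ
    ... | yes _ = refl
    ... | no _  = refl
  critical-root-values oneCritical = total-0 elements
  critical-root-values bad         = total-0 elements

  addChild-allRegular : ∀ k f → [ isAllRegular (addChild k f) ] ≡ [ isRegular k ] * [ isAllRegular f ]
  addChild-allRegular (regular g) (allRegular σ) = refl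
  addChild-allRegular (regular g) oneCritical    = refl
  addChild-allRegular (regular g) bad            = refl
  addChild-allRegular critical    (allRegular σ) = refl
  addChild-allRegular critical    oneCritical    = refl
  addChild-allRegular critical    bad            = refl
  addChild-allRegular degenerate  (allRegular σ) = refl
  addChild-allRegular degenerate  oneCritical    = refl
  addChild-allRegular degenerate  bad            = refl

  addChild-oneCritical : ∀ k f → [ isOneCritical (addChild k f) ]
    ≡ [ isRegular k ] * [ isOneCritical f ] + [ isCritical k ] * [ isAllRegular f ]
  addChild-oneCritical (regular g) (allRegular σ) = refl
  addChild-oneCritical (regular g) oneCritical    = refl
  addChild-oneCritical (regular g) bad            = refl
  addChild-oneCritical critical    (allRegular σ) = refl
  addChild-oneCritical critical    oneCritical    = refl
  addChild-oneCritical critical    bad            = refl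
  addChild-oneCritical degenerate  (allRegular σ) = refl
  addChild-oneCritical degenerate  oneCritical    = refl
  addChild-oneCritical degenerate  bad            = refl

  total-vertex : ∀ cs (φ : Class → Bool) → total ([_] ∘ φ ∘ classify (node cs)) (allV (node cs))
    ≡ total (λ ds → total (λ d → [ φ (vertexClass d (classifyF cs ds)) ]) elements) (allVs cs)
  total-vertex cs φ = trans (total-× _ elements (allVs cs))
                            (total-swap (λ d ds → [ φ (vertexClass d (classifyF cs ds)) ]) elements (allVs cs))

  #regular-node : ∀ cs → #regular (node cs) ≡ (Q - pos 1) * #allRegular cs + Q * #oneCritical cs
  #regular-node cs = begin
    #regular (node cs)
      ≡⟨ total-vertex cs isRegular ⟩
    total (λ ds → total (λ d → [ isRegular (vertexClass d (classifyF cs ds)) ]) elements) (allVs cs)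
      ≡⟨ total-cong (allVs cs) (λ ds → regular-root-values (classifyF cs ds)) ⟩
    total (λ ds → (Q - pos 1) * [ isAllRegular (classifyF cs ds) ] + Q * [ isOneCritical (classifyF cs ds) ]) (allVs cs)
      ≡⟨ total-+ _ _ (allVs cs) ⟩
    total (λ ds → (Q - pos 1) * [ isAllRegular (classifyF cs ds) ]) (allVs cs)
      + total (λ ds → Q * [ isOneCritical (classifyF cs ds) ]) (allVs cs)
      ≡⟨ cong₂ _+_ (total-*ˡ (Q - pos 1) _ (allVs cs)) (total-*ˡ Q _ (allVs cs)) ⟩
    (Q - pos 1) * #allRegular cs + Q * #oneCritical cs ∎

  #critical-node : ∀ cs → #critical (node cs) ≡ #allRegular cs
  #critical-node cs = trans (total-vertex cs isCritical)
                            (total-cong (allVs cs) (λ ds → critical-root-values (classifyF cs ds)))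

  #allRegular-∷ : ∀ c cs → #allRegular (c ∷ cs) ≡ #regular c * #allRegular cs
  #allRegular-∷ c cs = begin
    #allRegular (c ∷ cs)
      ≡⟨ total-× _ (allV c) (allVs cs) ⟩
    total (λ x → total (λ ys → [ isAllRegular (addChild (classify c x) (classifyF cs ys)) ]) (allVs cs)) (allV c)
      ≡⟨ total-cong (allV c) (λ x → trans (total-cong (allVs cs) (λ ys → addChild-allRegular (classify c x) (classifyF cs ys)))
                                          (total-*ˡ [ isRegular (classify c x) ] ([_] ∘ isAllRegular ∘ classifyF cs) (allVs cs))) ⟩
    total (λ x → [ isRegular (classify c x) ] * #allRegular cs) (allV c)
      ≡⟨ total-*ʳ (#allRegular cs) _ (allV c) ⟩
    #regular c * #allRegular cs ∎

  #oneCritical-∷ : ∀ c cs → #oneCritical (c ∷ cs) ≡ #regular c * #oneCritical cs + #critical c * #allRegular cs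
  #oneCritical-∷ c cs = begin
    #oneCritical (c ∷ cs)
      ≡⟨ total-× _ (allV c) (allVs cs) ⟩
    total (λ x → total (λ ys → [ isOneCritical (addChild (classify c x) (classifyF cs ys)) ]) (allVs cs)) (allV c)
      ≡⟨ total-cong (allV c) per-child ⟩
    total (λ x → r x * #oneCritical cs + z x * #allRegular cs) (allV c)
      ≡⟨ trans (total-+ (λ x → r x * #oneCritical cs) (λ x → z x * #allRegular cs) (allV c))
               (cong₂ _+_ (total-*ʳ (#oneCritical cs) r (allV c)) (total-*ʳ (#allRegular cs) z (allV c))) ⟩
    #regular c * #oneCritical cs + #critical c * #allRegular cs ∎
    where
    r z : V c → ℤ
    r x = [ isRegular (classify c x) ]
    z x = [ isCritical (classify c x) ]
    o a : Vs cs → ℤ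
    o ys = [ isOneCritical (classifyF cs ys) ]
    a ys = [ isAllRegular (classifyF cs ys) ]
    per-child : ∀ x → total (λ ys → [ isOneCritical (addChild (classify c x) (classifyF cs ys)) ]) (allVs cs)
                      ≡ r x * #oneCritical cs + z x * #allRegular cs
    per-child x = begin
      total (λ ys → [ isOneCritical (addChild (classify c x) (classifyF cs ys)) ]) (allVs cs)
        ≡⟨ total-cong (allVs cs) (λ ys → addChild-oneCritical (classify c x) (classifyF cs ys)) ⟩
      total (λ ys → r x * o ys + z x * a ys) (allVs cs)
        ≡⟨ total-+ (λ ys → r x * o ys) (λ ys → z x * a ys) (allVs cs) ⟩
      total (λ ys → r x * o ys) (allVs cs) + total (λ ys → z x * a ys) (allVs cs)
        ≡⟨ cong₂ _+_ (total-*ˡ (r x) o (allVs cs)) (total-*ˡ (z x) a (allVs cs)) ⟩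
      r x * #oneCritical cs + z x * #allRegular cs ∎

  mutual
    #regular≡S : ∀ R → #regular R ≡ eval (S R) Q
    #regular≡S (node cs) = begin
      #regular (node cs)                                 ≡⟨ #regular-node cs ⟩
      (Q - pos 1) * #allRegular cs + Q * #oneCritical cs ≡⟨ cong₂ (λ a b → (Q - pos 1) * a + Q * b) (#allRegular≡a cs) (#oneCritical≡b cs) ⟩
      (Q - pos 1) * eval (proj₁ (abProd cs)) Q + Q * eval (proj₂ (abProd cs)) Q ≡⟨ sym (eval-S (node cs) Q) ⟩
      eval (S (node cs)) Q                               ∎

    #critical≡a : ∀ R → #critical R ≡ eval (proj₁ (ab R)) Q
    #critical≡a (node cs) = trans (#critical-node cs) (#allRegular≡a cs)

    #allRegular≡a : ∀ cs → #allRegular cs ≡ eval (proj₁ (abProd cs)) Q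
    #allRegular≡a []       = sym (eval-1 Q)
    #allRegular≡a (c ∷ cs) = begin
      #allRegular (c ∷ cs)                        ≡⟨ #allRegular-∷ c cs ⟩
      #regular c * #allRegular cs                 ≡⟨ cong₂ _*_ (#regular≡S c) (#allRegular≡a cs) ⟩
      eval (S c) Q * eval (proj₁ (abProd cs)) Q   ≡⟨ sym (eval-* (S c) _ Q) ⟩
      eval (proj₁ (abProd (c ∷ cs))) Q            ∎

    #oneCritical≡b : ∀ cs → #oneCritical cs ≡ eval (proj₂ (abProd cs)) Q
    #oneCritical≡b []       = refl
    #oneCritical≡b (c ∷ cs) = begin
      #oneCritical (c ∷ cs)
        ≡⟨ #oneCritical-∷ c cs ⟩
      #regular c * #oneCritical cs + #critical c * #allRegular cs
        ≡⟨ cong₂ _+_ (cong₂ _*_ (#regular≡S c) (#oneCritical≡b cs)) (cong₂ _*_ (#critical≡a c) (#allRegular≡a cs)) ⟩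
      eval (S c) Q * eval (proj₂ (abProd cs)) Q + eval (proj₁ (ab c)) Q * eval (proj₁ (abProd cs)) Q
        ≡⟨ sym (trans (eval-+ (S c *ₚ proj₂ (abProd cs)) (proj₁ (ab c) *ₚ proj₁ (abProd cs)) Q)
                      (cong₂ _+_ (eval-* (S c) _ Q) (eval-* (proj₁ (ab c)) _ Q))) ⟩
      eval (proj₂ (abProd (c ∷ cs))) Q ∎

module InvertibleDiagonals {q : ℕ} (F : FiniteField q) (R : RTree) where
  open Arithmetic F using (Carrier)
  open Matrices F
  open TreeVectors F
  open Elimination F
  open Flattening F
  open Invertibility F
  open Counting F
  open Counts using (length-filter)

  regular? : (d : V R) → Dec (T (isRegular (classify R d)))
  regular? d = T? (isRegular (classify R d))

  diagonals : List (Vec Carrier (size R))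
  diagonals = List.map (flat R) (List.filter regular? (allV R))

  diagonals-unique : Unique diagonals
  diagonals-unique = UniqueP.map⁺ flat-injective (UniqueP.filter⁺ regular? (allV-unique R))
    where
    flat-injective : ∀ {x y} → flat R x ≡ flat R y → x ≡ y
    flat-injective {x} {y} e = trans (sym (unflat∘flat R x)) (trans (cong (unflat R) e) (unflat∘flat R y))

  diagonals-invertible : ∀ dv → (dv ∈ diagonals) ⇔ Invertible (schrodinger R dv)
  diagonals-invertible dv = mk⇔ to from
    where
    to : dv ∈ diagonals → Invertible (schrodinger R dv)
    to dv∈ with ∈P.∈-map⁻ (flat R) dv∈
    ... | d , d∈ , refl = Equivalence.from (invertible⇔regular R (flat R d))
      (subst (λ x → T (isRegular (classify R x))) (sym (unflat∘flat R d)) (proj₂ (∈P.∈-filter⁻ regular? {xs = allV R} d∈)))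
    from : Invertible (schrodinger R dv) → dv ∈ diagonals
    from inv = subst (_∈ diagonals) (flat∘unflat R dv)
      (∈P.∈-map⁺ (flat R) (∈P.∈-filter⁺ regular? (allV-complete R (unflat R dv)) (Equivalence.to (invertible⇔regular R dv) inv)))

  diagonals-count : ℤ.+ length diagonals ≡ eval (S R) (ℤ.+ q)
  diagonals-count = begin
    ℤ.+ length diagonals                        ≡⟨ cong ℤ.+_ (ListP.length-map (flat R) (List.filter regular? (allV R))) ⟩
    ℤ.+ length (List.filter regular? (allV R))  ≡⟨ length-filter (isRegular ∘ classify R) (allV R) ⟩
    #regular R                                  ≡⟨ #regular≡S R ⟩
    eval (S R) (ℤ.+ q)                          ∎
    where open ≡-Reasoning

open import Data.Integer using (+_)

proposition2 : (R : RTree) (q : ℕ) (F : FiniteField q) →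
    let open FiniteField F using (Carrier) in
    let open Matrices F in
    Σ (List (Vec Carrier (size R))) λ L →
      Unique L
      × (∀ d → (d ∈ L) ⇔ Invertible (schrodinger R d))
      × (eval (S R) (+ q) ≡ + length L)
proposition2 R q F = diagonals , diagonals-unique , diagonals-invertible , sym diagonals-count
  where open InvertibleDiagonals F R
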